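{- Let $G(u)=\sum_P x^{\mathrm{sper}(P)}u^{\mathrm{first}(P)}$, summed over all Stanley polyominoes $P$, and let \[ r=\frac{1+x-x^{2}-\sqrt{x^{4}-2x^{3}-x^{2}-2x+1}}{2x},\qquad s=\frac{1+x-x^{2}+\sqrt{x^{4}-2x^{3}-x^{2}-2x+1}}{2x}. \] Then \[ G(u)=\frac{xu}{r(s-u)}=\frac{\left(x^{2}u-xu-u+2-\sqrt{x^{4}-2x^{3}-x^{2}-2x+1}\,u\right)x^2u}{2\left(u^{2}x+x^{2}u-xu-u+1\right)}. \] Moreover, $[u^k]G(u)=x^2(rx)^{k-1}$, and for $k\geq 2$ and $n\geq k+1$, \[ [x^nu^k]G(u)=\sum_{j=0}^{n-k-1}\frac{k-1}{2j+k-1}\binom{2j+k-1}{j}(-1)^{n-k-1-j}\sum_{b=0}^{\left\lfloor\frac{n-k-1-j}{2}\right\rfloor}\binom{n+j-b-3}{n-k-1-j-b}\binom{n-k-1-j-b}{b}. \]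
   Context: Cells are unit squares $[i,i+1]\times[j,j+1]$ with $i,j\in\mathbb{Z}$. A Stanley polyomino (up to translation) is a set of cells forming $k\geq 1$ rows $0,\dots,k-1$ (bottom to top), row $j$ consisting of the cells with $s_j\le i\le e_j$ ($s_j\le e_j$ integers), such that $s_{j-1}<s_j\le e_{j-1}<e_j$ for $1\le j\le k-1$. The semiperimeter is $\mathrm{sper}(P)=\mathrm{col}(P)+\mathrm{row}(P)$, where $\mathrm{col}(P)=e_{k-1}-s_0+1$ is the number of columns and $\mathrm{row}(P)=k$ the number of rows; $\mathrm{first}(P)=e_0-s_0+1$ is the number of cells in the first (bottom) row. -}

module Defs where

open import Data.Nat as ℕ using (ℕ; zero; suc; _∸_; _≤_; _<_)
open import Data.Nat.Combinatorics using (_C_)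
open import Data.Integer as ℤ using (ℤ; +_)
open import Data.Rational as ℚ using (ℚ; 0ℚ; 1ℚ)
open import Data.Product using (_×_; _,_; Σ-syntax)
open import Data.Unit using (⊤)
open import Data.Empty using (⊥)
open import Data.List using (List; []; _∷_; length; upTo)
open import Data.List.Membership.Propositional using (_∈_)
open import Data.List.Relation.Unary.Unique.Propositional using (Unique)
open import Function.Bundles using (_⇔_)
open import Relation.Binary.PropositionalEquality using (_≡_)

-- A polyomino is given by its list of rows (s_j , e_j), bottom row first.
-- Translation is normalised by s_0 = 0 (all s_j ≥ s_0 = 0, so ℕ suffices);
-- the rows are already numbered 0,…,k-1.

Row : Set
Row = ℕ × ℕ

ChainFrom : Row → List Row → Set
ChainFrom _ [] = ⊤
ChainFrom (s , e) ((s′ , e′) ∷ rest) =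
  s < s′ × s′ ≤ e × e < e′ × s′ ≤ e′ × ChainFrom (s′ , e′) rest

Stanley : List Row → Set
Stanley [] = ⊥
Stanley ((s , e) ∷ rest) = s ≡ 0 × s ≤ e × ChainFrom (s , e) rest

lastEnd : Row → List Row → ℕ
lastEnd (_ , e) [] = e
lastEnd _ (r ∷ rest) = lastEnd r rest

col : List Row → ℕ
col [] = 0
col ((s , e) ∷ rest) = suc (lastEnd (s , e) rest) ∸ s

rowCount : List Row → ℕ
rowCount = length

sper : List Row → ℕ
sper P = col P ℕ.+ rowCount P

first : List Row → ℕ
first [] = 0
first ((s , e) ∷ _) = suc e ∸ s

IsCount : ℕ → ℕ → ℕ → Set
IsCount n k c = Σ[ L ∈ List (List Row) ]
  (Unique L × (∀ P → (P ∈ L) ⇔ (Stanley P × sper P ≡ n × first P ≡ k)) × length L ≡ c)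

-- Formal power series in two variables x, u with integer coefficients:
-- f n k is the coefficient of x^n u^k.

Ser : Set
Ser = ℕ → ℕ → ℤ

sumℤ≤ : ℕ → (ℕ → ℤ) → ℤ
sumℤ≤ zero f = f 0
sumℤ≤ (suc n) f = sumℤ≤ n f ℤ.+ f (suc n)

infix  4 _≈_
infixl 6 _⊕_ _⊖_
infixl 7 _⊗_
infixr 8 _^ˢ_

_≈_ : Ser → Ser → Set
f ≈ g = ∀ n k → f n k ≡ g n k

_⊕_ : Ser → Ser → Ser
(f ⊕ g) n k = f n k ℤ.+ g n k

_⊖_ : Ser → Ser → Ser
(f ⊖ g) n k = f n k ℤ.- g n k

_⊗_ : Ser → Ser → Ser
(f ⊗ g) n k = sumℤ≤ n (λ i → sumℤ≤ k (λ j → f i j ℤ.* g (n ∸ i) (k ∸ j)))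

con : ℤ → Ser
con c zero zero = c
con _ _ _ = + 0

X : Ser
X (suc zero) zero = + 1
X _ _ = + 0

U : Ser
U zero (suc zero) = + 1
U _ _ = + 0

_^ˢ_ : Ser → ℕ → Ser
f ^ˢ zero = con (+ 1)
f ^ˢ suc m = f ⊗ (f ^ˢ m)

Disc : Ser
Disc = X ^ˢ 4 ⊖ con (+ 2) ⊗ X ^ˢ 3 ⊖ X ^ˢ 2 ⊖ con (+ 2) ⊗ X ⊕ con (+ 1)

sumℚ< : ℕ → (ℕ → ℚ) → ℚ
sumℚ< zero f = 0ℚ
sumℚ< (suc n) f = sumℚ< n f ℚ.+ f n

-- a / b as a rational (convention a / 0 = 0; never used with b = 0 below)
frac : ℕ → ℕ → ℚ
frac a zero = 0ℚ
frac a (suc b) = (+ a) ℚ./ suc b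

natℚ : ℕ → ℚ
natℚ a = (+ a) ℚ./ 1

sign : ℕ → ℚ
sign zero = 1ℚ
sign (suc m) = ℚ.- sign m

coeffFormula : ℕ → ℕ → ℚ
coeffFormula n k =
  sumℚ< (n ∸ k) (λ j →
    frac (k ∸ 1) (2 ℕ.* j ℕ.+ k ∸ 1) ℚ.* natℚ ((2 ℕ.* j ℕ.+ k ∸ 1) C j)
    ℚ.* sign (n ∸ k ∸ 1 ∸ j)
    ℚ.* sumℚ< (suc ((n ∸ k ∸ 1 ∸ j) ℕ./ 2)) (λ b →
          natℚ (((n ℕ.+ j ∸ b ∸ 3) C (n ∸ k ∸ 1 ∸ j ∸ b))
                ℕ.* ((n ∸ k ∸ 1 ∸ j ∸ b) C b))))

toSer : (ℕ → ℕ → ℕ) → Ser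
toSer g n k = + g n k

{-# OPTIONS --safe --termination-depth=2 #-}
module Submission where

-- A Stanley polyomino whose bottom row has k + 2 ≥ 2 cells either has its second row starting in
-- column ≥ 2, and deleting column 1 leaves one with bottom row of k + 1 cells, or its second row
-- starts in column 1, and deleting the bottom row leaves one with bottom row of k + 2 + i cells.
-- Hence g(n+2, k+2) = g(n+1, k+1) + Σ_{i<n} g(n, k+2+i).  The series H_k = x² (r x)^(k-1) obey the
-- same recurrence because t = r x is the root of t² - (1 + x - x²) t + x = 0 with t(0) = 0, so
-- [u^k] G = H_k, and both closed forms of G are checked one power of u at a time (the hypotheses
-- force q, r and s̃ to be free of u, as q² = Disc and q(0, 0) = 1).
-- For the coefficients, R = r satisfies (1 + x - x²) R = 1 + x R², and Lagrange inversion gives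
-- R^p = Σ_j p/(2j+p) C(2j+p, j) x^j (1 + x - x²)^(-2j-p); this is proved by checking that both sides
-- satisfy P F(p+1) = F(p) + x F(p+2) with F(0) = 1.  Expanding (1 + x - x²)^(-N) = Σ_l (x (x - 1))^l
-- gives the double sum.

open import Defs
open import Data.Nat using (ℕ)
open import Data.Integer using (+_)
open import Relation.Binary.PropositionalEquality using (_≡_)

module FiniteSums where

  open import Data.Nat as ℕ using (ℕ; zero; suc; _∸_; _≤_; _<_; z≤n; s≤s)
  import Data.Nat.Properties as ℕ
  open import Data.Integer using (ℤ; 0ℤ; _+_; _*_)
  import Data.Integer.Properties as ℤ
  open import Data.Integer.Tactic.RingSolver using (solve-∀)
  open import Relation.Binary.PropositionalEquality
  open import Relation.Nullary using (¬_; yes; no)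

  sum-cong : ∀ n {f g : ℕ → ℤ} → (∀ i → i ≤ n → f i ≡ g i) → sumℤ≤ n f ≡ sumℤ≤ n g
  sum-cong zero    f≡g = f≡g 0 z≤n
  sum-cong (suc n) f≡g =
    cong₂ _+_ (sum-cong n (λ i i≤n → f≡g i (ℕ.m≤n⇒m≤1+n i≤n))) (f≡g (suc n) ℕ.≤-refl)

  sum-ext : ∀ n {f g : ℕ → ℤ} → (∀ i → f i ≡ g i) → sumℤ≤ n f ≡ sumℤ≤ n g
  sum-ext n f≡g = sum-cong n (λ i _ → f≡g i)

  sum-zero : ∀ n {f : ℕ → ℤ} → (∀ i → i ≤ n → f i ≡ 0ℤ) → sumℤ≤ n f ≡ 0ℤ
  sum-zero zero    f≡0 = f≡0 0 z≤n
  sum-zero (suc n) f≡0 =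
    cong₂ _+_ (sum-zero n (λ i i≤n → f≡0 i (ℕ.m≤n⇒m≤1+n i≤n))) (f≡0 (suc n) ℕ.≤-refl)

  sum-distrib-+ : ∀ n (f g : ℕ → ℤ) → sumℤ≤ n (λ i → f i + g i) ≡ sumℤ≤ n f + sumℤ≤ n g
  sum-distrib-+ zero    f g = refl
  sum-distrib-+ (suc n) f g = begin
    sumℤ≤ n (λ i → f i + g i) + (f (suc n) + g (suc n))
      ≡⟨ cong (_+ (f (suc n) + g (suc n))) (sum-distrib-+ n f g) ⟩
    (sumℤ≤ n f + sumℤ≤ n g) + (f (suc n) + g (suc n))
      ≡⟨ medial (sumℤ≤ n f) (sumℤ≤ n g) (f (suc n)) (g (suc n)) ⟩
    (sumℤ≤ n f + f (suc n)) + (sumℤ≤ n g + g (suc n)) ∎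
    where
    open ≡-Reasoning
    medial : ∀ a b c d → (a + b) + (c + d) ≡ (a + c) + (b + d)
    medial = solve-∀

  *-distribˡ-sum : ∀ n c (f : ℕ → ℤ) → c * sumℤ≤ n f ≡ sumℤ≤ n (λ i → c * f i)
  *-distribˡ-sum zero    c f = refl
  *-distribˡ-sum (suc n) c f =
    trans (ℤ.*-distribˡ-+ c (sumℤ≤ n f) (f (suc n)))
          (cong (_+ c * f (suc n)) (*-distribˡ-sum n c f))

  *-distribʳ-sum : ∀ n c (f : ℕ → ℤ) → sumℤ≤ n f * c ≡ sumℤ≤ n (λ i → f i * c)
  *-distribʳ-sum n c f =
    trans (ℤ.*-comm (sumℤ≤ n f) c)
          (trans (*-distribˡ-sum n c f) (sum-ext n (λ i → ℤ.*-comm c (f i))))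

  sum-head : ∀ n (f : ℕ → ℤ) → sumℤ≤ (suc n) f ≡ f 0 + sumℤ≤ n (λ i → f (suc i))
  sum-head zero    f = refl
  sum-head (suc n) f =
    trans (cong (_+ f (suc (suc n))) (sum-head n f)) (ℤ.+-assoc (f 0) _ _)

  sum-comm : ∀ n k (a : ℕ → ℕ → ℤ) →
    sumℤ≤ n (λ i → sumℤ≤ k (λ j → a i j)) ≡ sumℤ≤ k (λ j → sumℤ≤ n (λ i → a i j))
  sum-comm zero    k a = refl
  sum-comm (suc n) k a =
    trans (cong (_+ sumℤ≤ k (a (suc n))) (sum-comm n k a))
          (sym (sum-distrib-+ k (λ j → sumℤ≤ n (λ i → a i j)) (a (suc n))))

  sum-reverse : ∀ n (f : ℕ → ℤ) → sumℤ≤ n f ≡ sumℤ≤ n (λ i → f (n ∸ i))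
  sum-reverse zero    f = refl
  sum-reverse (suc n) f = begin
    sumℤ≤ n f + f (suc n)                    ≡⟨ ℤ.+-comm (sumℤ≤ n f) _ ⟩
    f (suc n) + sumℤ≤ n f                    ≡⟨ cong (λ z → f (suc n) + z) (sum-reverse n f) ⟩
    f (suc n) + sumℤ≤ n (λ i → f (n ∸ i))    ≡⟨ sum-head n (λ i → f (suc n ∸ i)) ⟨
    sumℤ≤ (suc n) (λ i → f (suc n ∸ i))      ∎
    where open ≡-Reasoning

  sum-triangle : ∀ n (F : ℕ → ℕ → ℤ) →
    sumℤ≤ n (λ i → sumℤ≤ i (λ a → F a i)) ≡
    sumℤ≤ n (λ a → sumℤ≤ (n ∸ a) (λ b → F a (a ℕ.+ b)))
  sum-triangle zero    F = refl
  sum-triangle (suc n) F = begin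
    sumℤ≤ n (λ i → sumℤ≤ i (λ a → F a i)) + sumℤ≤ (suc n) (λ a → F a (suc n))
      ≡⟨ cong (_+ sumℤ≤ (suc n) (λ a → F a (suc n))) (sum-triangle n F) ⟩
    sumℤ≤ n rows + (sumℤ≤ n (λ a → F a (suc n)) + F (suc n) (suc n))
      ≡⟨ ℤ.+-assoc (sumℤ≤ n rows) _ _ ⟨
    (sumℤ≤ n rows + sumℤ≤ n (λ a → F a (suc n))) + F (suc n) (suc n)
      ≡⟨ cong (_+ F (suc n) (suc n)) (sum-distrib-+ n rows (λ a → F a (suc n))) ⟨
    sumℤ≤ n (λ a → rows a + F a (suc n)) + F (suc n) (suc n)
      ≡⟨ cong₂ _+_ (sum-cong n extend-row) (cong (F (suc n)) (sym (ℕ.+-identityʳ (suc n)))) ⟩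
    sumℤ≤ n rows′ + F (suc n) (suc n ℕ.+ 0)
      ≡⟨ cong (λ m → sumℤ≤ n rows′ + sumℤ≤ m (λ b → F (suc n) (suc n ℕ.+ b)))
              (ℕ.n∸n≡0 (suc n)) ⟨
    sumℤ≤ (suc n) rows′ ∎
    where
    open ≡-Reasoning
    rows rows′ : ℕ → ℤ
    rows  a = sumℤ≤ (n ∸ a) (λ b → F a (a ℕ.+ b))
    rows′ a = sumℤ≤ (suc n ∸ a) (λ b → F a (a ℕ.+ b))
    extend-row : ∀ a → a ≤ n → rows a + F a (suc n) ≡ rows′ a
    extend-row a a≤n rewrite ℕ.+-∸-assoc 1 a≤n =
      cong (λ m → rows a + F a m)
        (trans (cong suc (sym (ℕ.m+[n∸m]≡n a≤n))) (sym (ℕ.+-suc a (n ∸ a))))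

  sum-single : ∀ n a (f : ℕ → ℤ) → a ≤ n → (∀ i → i ≤ n → ¬ i ≡ a → f i ≡ 0ℤ) →
    sumℤ≤ n f ≡ f a
  sum-single zero    zero f _ others≡0 = refl
  sum-single (suc n) a  f a≤ others≡0 with a ℕ.≟ suc n
  ... | yes refl =
    trans (cong (_+ f (suc n)) (sum-zero n (λ i i≤n →
             others≡0 i (ℕ.m≤n⇒m≤1+n i≤n) (λ { refl → ℕ.<-irrefl refl (s≤s i≤n) }))))
          (ℤ.+-identityˡ _)
  ... | no a≢ =
    trans (cong₂ _+_ (sum-single n a f (ℕ.≤-pred (ℕ.≤∧≢⇒< a≤ a≢))
                        (λ i i≤n → others≡0 i (ℕ.m≤n⇒m≤1+n i≤n)))
                     (others≡0 (suc n) ℕ.≤-refl (λ e → a≢ (sym e))))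
          (ℤ.+-identityʳ _)

  sum-truncate : ∀ K L (f : ℕ → ℤ) → (∀ i → K < i → f i ≡ 0ℤ) →
    sumℤ≤ (K ℕ.+ L) f ≡ sumℤ≤ K f
  sum-truncate K zero    f tail≡0 = cong (λ m → sumℤ≤ m f) (ℕ.+-identityʳ K)
  sum-truncate K (suc L) f tail≡0 =
    trans (cong (λ m → sumℤ≤ m f) (ℕ.+-suc K L))
          (trans (cong₂ _+_ (sum-truncate K L f tail≡0) (tail≡0 (suc (K ℕ.+ L)) (s≤s (ℕ.m≤m+n K L))))
                 (ℤ.+-identityʳ _))

  sumℤ< : ℕ → (ℕ → ℤ) → ℤ
  sumℤ< zero    f = 0ℤ
  sumℤ< (suc L) f = sumℤ< L f + f L

  sumℤ<-ext : ∀ L {f g : ℕ → ℤ} → (∀ i → f i ≡ g i) → sumℤ< L f ≡ sumℤ< L g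
  sumℤ<-ext zero    f≡g = refl
  sumℤ<-ext (suc L) f≡g = cong₂ _+_ (sumℤ<-ext L f≡g) (f≡g L)

module PowerSeries where

  open FiniteSums
  open import Data.Nat as ℕ using (ℕ; zero; suc; _∸_; _≤_; _<_; z≤n; s≤s)
  import Data.Nat.Properties as ℕ
  open import Data.Nat.Induction using (<-rec)
  open import Data.Integer as ℤ using (ℤ; +_; 0ℤ; 1ℤ; _+_; _*_; -_)
  import Data.Integer.Properties as ℤ
  open import Data.Maybe using (Maybe; nothing; just)
  open import Data.Product using (_,_)
  open import Data.Sum using (inj₁; inj₂)
  open import Data.Empty using (⊥-elim)
  open import Algebra.Bundles using (CommutativeRing)
  open import Algebra.Structures using (IsCommutativeRing)
  open import Algebra.Solver.Ring.AlmostCommutativeRing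
    using (fromCommutativeRing; _-Raw-AlmostCommutative⟶_)
  import Algebra.Solver.Ring
  open import Relation.Binary.Structures using (IsEquivalence)
  open import Relation.Binary.Bundles using (Setoid)
  import Relation.Binary.Reasoning.Setoid
  open import Relation.Binary.PropositionalEquality
  open import Relation.Nullary using (¬_; yes; no)

  Series : Set
  Series = ℕ → ℤ

  infix  4 _≐_
  infixl 6 _+ₛ_ _-ₛ_
  infixl 7 _*ₛ_
  infixr 8 _^ₛ_

  _≐_ : Series → Series → Set
  f ≐ g = ∀ n → f n ≡ g n

  _+ₛ_ : Series → Series → Series
  (f +ₛ g) n = f n + g n

  -ₛ_ : Series → Series
  (-ₛ f) n = - f n

  _-ₛ_ : Series → Series → Series
  f -ₛ g = f +ₛ (-ₛ g)

  constₛ : ℤ → Series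
  constₛ c zero    = c
  constₛ c (suc _) = 0ℤ

  0ₛ 1ₛ xₛ : Series
  0ₛ _ = 0ℤ
  1ₛ = constₛ 1ℤ
  xₛ zero          = 0ℤ
  xₛ (suc zero)    = 1ℤ
  xₛ (suc (suc _)) = 0ℤ

  _*ₛ_ : Series → Series → Series
  (f *ₛ g) n = sumℤ≤ n (λ i → f i * g (n ∸ i))

  _^ₛ_ : Series → ℕ → Series
  f ^ₛ zero  = 1ₛ
  f ^ₛ suc m = f *ₛ f ^ₛ m

  ≐-isEquivalence : IsEquivalence _≐_
  ≐-isEquivalence = record
    { refl  = λ _ → refl
    ; sym   = λ f≐g n → sym (f≐g n)
    ; trans = λ f≐g g≐h n → trans (f≐g n) (g≐h n)
    }

  open IsEquivalence ≐-isEquivalence public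
    using () renaming (refl to ≐-refl; sym to ≐-sym; trans to ≐-trans)

  ≐-setoid : Setoid _ _
  ≐-setoid = record { isEquivalence = ≐-isEquivalence }

  module SeriesReasoning = Relation.Binary.Reasoning.Setoid ≐-setoid

  +ₛ-cong : ∀ {f f′ g g′} → f ≐ f′ → g ≐ g′ → f +ₛ g ≐ f′ +ₛ g′
  +ₛ-cong f≐f′ g≐g′ n = cong₂ _+_ (f≐f′ n) (g≐g′ n)

  -ₛ-cong : ∀ {f f′} → f ≐ f′ → -ₛ f ≐ -ₛ f′
  -ₛ-cong f≐f′ n = cong -_ (f≐f′ n)

  *ₛ-cong : ∀ {f f′ g g′} → f ≐ f′ → g ≐ g′ → f *ₛ g ≐ f′ *ₛ g′
  *ₛ-cong f≐f′ g≐g′ n = sum-ext n (λ i → cong₂ _*_ (f≐f′ i) (g≐g′ (n ∸ i)))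

  ^ₛ-cong : ∀ {f g} → f ≐ g → ∀ m → f ^ₛ m ≐ g ^ₛ m
  ^ₛ-cong f≐g zero    = ≐-refl
  ^ₛ-cong f≐g (suc m) = *ₛ-cong f≐g (^ₛ-cong f≐g m)

  *ₛ-comm : ∀ f g → f *ₛ g ≐ g *ₛ f
  *ₛ-comm f g n = trans (sum-reverse n _) (sum-cong n (λ i i≤n →
    trans (cong (λ m → f (n ∸ i) * g m) (ℕ.m∸[m∸n]≡n i≤n)) (ℤ.*-comm (f (n ∸ i)) (g i))))

  *ₛ-assoc : ∀ f g h → (f *ₛ g) *ₛ h ≐ f *ₛ (g *ₛ h)
  *ₛ-assoc f g h n = begin
    sumℤ≤ n (λ i → sumℤ≤ i (λ a → f a * g (i ∸ a)) * h (n ∸ i))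
      ≡⟨ sum-ext n (λ i → *-distribʳ-sum i (h (n ∸ i)) _) ⟩
    sumℤ≤ n (λ i → sumℤ≤ i (λ a → f a * g (i ∸ a) * h (n ∸ i)))
      ≡⟨ sum-triangle n (λ a i → f a * g (i ∸ a) * h (n ∸ i)) ⟩
    sumℤ≤ n (λ a → sumℤ≤ (n ∸ a) (λ b → f a * g (a ℕ.+ b ∸ a) * h (n ∸ (a ℕ.+ b))))
      ≡⟨ sum-ext n (λ a → sum-ext (n ∸ a) (λ b →
           trans (cong₂ (λ i j → f a * g i * h j) (ℕ.m+n∸m≡n a b) (sym (ℕ.∸-+-assoc n a b)))
                 (ℤ.*-assoc (f a) (g b) (h (n ∸ a ∸ b))))) ⟩
    sumℤ≤ n (λ a → sumℤ≤ (n ∸ a) (λ b → f a * (g b * h (n ∸ a ∸ b))))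
      ≡⟨ sum-ext n (λ a → *-distribˡ-sum (n ∸ a) (f a) _) ⟨
    sumℤ≤ n (λ a → f a * sumℤ≤ (n ∸ a) (λ b → g b * h (n ∸ a ∸ b))) ∎
    where open ≡-Reasoning

  constₛ-scale : ∀ c f n → (constₛ c *ₛ f) n ≡ c * f n
  constₛ-scale c f zero    = refl
  constₛ-scale c f (suc n) =
    trans (sum-head n (λ i → constₛ c i * f (suc n ∸ i)))
          (trans (cong (λ z → c * f (suc n) + z) (sum-zero n (λ i _ → ℤ.*-zeroˡ (f (n ∸ i)))))
                 (ℤ.+-identityʳ (c * f (suc n))))

  constₛ-0 : constₛ 0ℤ ≐ 0ₛ
  constₛ-0 zero    = refl
  constₛ-0 (suc n) = refl

  constₛ-+ : ∀ c d → constₛ (c + d) ≐ constₛ c +ₛ constₛ d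
  constₛ-+ c d zero    = refl
  constₛ-+ c d (suc n) = refl

  ≐0ₛ⇒≐constₛ0 : ∀ {f} → f ≐ 0ₛ → f ≐ constₛ 0ℤ
  ≐0ₛ⇒≐constₛ0 f≐0 = ≐-trans f≐0 (≐-sym constₛ-0)

  *ₛ-identityˡ : ∀ f → 1ₛ *ₛ f ≐ f
  *ₛ-identityˡ f n = trans (constₛ-scale 1ℤ f n) (ℤ.*-identityˡ (f n))

  *ₛ-distribˡ : ∀ f g h → f *ₛ (g +ₛ h) ≐ f *ₛ g +ₛ f *ₛ h
  *ₛ-distribˡ f g h n =
    trans (sum-ext n (λ i → ℤ.*-distribˡ-+ (f i) (g (n ∸ i)) (h (n ∸ i)))) (sum-distrib-+ n _ _)

  *ₛ-distribʳ : ∀ f g h → (g +ₛ h) *ₛ f ≐ g *ₛ f +ₛ h *ₛ f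
  *ₛ-distribʳ f g h n =
    trans (sum-ext n (λ i → ℤ.*-distribʳ-+ (f (n ∸ i)) (g i) (h i))) (sum-distrib-+ n _ _)

  *ₛ-zeroˡ : ∀ f → 0ₛ *ₛ f ≐ 0ₛ
  *ₛ-zeroˡ f n = sum-zero n (λ i _ → ℤ.*-zeroˡ (f (n ∸ i)))

  *ₛ-zeroʳ : ∀ f → f *ₛ 0ₛ ≐ 0ₛ
  *ₛ-zeroʳ f n = sum-zero n (λ i _ → ℤ.*-zeroʳ (f i))

  Series-isCommutativeRing : IsCommutativeRing _≐_ _+ₛ_ _*ₛ_ -ₛ_ 0ₛ 1ₛ
  Series-isCommutativeRing = record
    { isRing = record
      { +-isAbelianGroup = record
        { isGroup = record
          { isMonoid = record
            { isSemigroup = record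
              { isMagma = record { isEquivalence = ≐-isEquivalence ; ∙-cong = +ₛ-cong }
              ; assoc   = λ f g h n → ℤ.+-assoc (f n) (g n) (h n)
              }
            ; identity = (λ f n → ℤ.+-identityˡ (f n)) , (λ f n → ℤ.+-identityʳ (f n))
            }
          ; inverse = (λ f n → ℤ.+-inverseˡ (f n)) , (λ f n → ℤ.+-inverseʳ (f n))
          ; ⁻¹-cong = -ₛ-cong
          }
        ; comm = λ f g n → ℤ.+-comm (f n) (g n)
        }
      ; *-cong     = *ₛ-cong
      ; *-assoc    = *ₛ-assoc
      ; *-identity = *ₛ-identityˡ , (λ f → ≐-trans (*ₛ-comm f 1ₛ) (*ₛ-identityˡ f))
      ; distrib    = *ₛ-distribˡ , *ₛ-distribʳ
      }
    ; *-comm = *ₛ-comm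
    }

  Series-commutativeRing : CommutativeRing _ _
  Series-commutativeRing = record { isCommutativeRing = Series-isCommutativeRing }

  constₛ-homomorphism :
    CommutativeRing.rawRing ℤ.+-*-commutativeRing
      -Raw-AlmostCommutative⟶ fromCommutativeRing Series-commutativeRing
  constₛ-homomorphism = record
    { ⟦_⟧    = constₛ
    ; +-homo = λ { c d zero → refl ; c d (suc n) → refl }
    ; *-homo = λ c d n → sym (trans (constₛ-scale c (constₛ d) n) (*-constₛ c d n))
    ; -‿homo = λ { c zero → refl ; c (suc n) → refl }
    ; 0-homo = λ { zero → refl ; (suc n) → refl }
    ; 1-homo = λ { zero → refl ; (suc n) → refl }
    }
    where
    *-constₛ : ∀ c d n → c * constₛ d n ≡ constₛ (c * d) n
    *-constₛ c d zero    = refl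
    *-constₛ c d (suc n) = ℤ.*-zeroʳ c

  constₛ-≟ : ∀ c d → Maybe (constₛ c ≐ constₛ d)
  constₛ-≟ c d with c ℤ.≟ d
  ... | yes refl = just ≐-refl
  ... | no _     = nothing

  module SeriesSolver =
    Algebra.Solver.Ring (CommutativeRing.rawRing ℤ.+-*-commutativeRing)
      (fromCommutativeRing Series-commutativeRing) constₛ-homomorphism constₛ-≟

  ≐⇒-ₛ≐0 : ∀ {f g} → f ≐ g → f -ₛ g ≐ 0ₛ
  ≐⇒-ₛ≐0 {f} {g} f≐g n = trans (cong (_+ - g n) (f≐g n)) (ℤ.+-inverseʳ (g n))

  -ₛ≐0⇒≐ : ∀ {f g} → f -ₛ g ≐ 0ₛ → f ≐ g
  -ₛ≐0⇒≐ {f} {g} f-g≐0 n = ℤ.i-j≡0⇒i≡j (f n) (g n) (f-g≐0 n)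

  zeroˡ⇒*ₛ≐0 : ∀ {f} g → f ≐ 0ₛ → f *ₛ g ≐ 0ₛ
  zeroˡ⇒*ₛ≐0 g f≐0 = ≐-trans (*ₛ-cong f≐0 (≐-refl {g})) (*ₛ-zeroˡ g)

  zeroʳ⇒*ₛ≐0 : ∀ f {g} → g ≐ 0ₛ → f *ₛ g ≐ 0ₛ
  zeroʳ⇒*ₛ≐0 f g≐0 = ≐-trans (*ₛ-cong (≐-refl {f}) g≐0) (*ₛ-zeroʳ f)

  x*ₛ-shift : ∀ f n → (xₛ *ₛ f) (suc n) ≡ f n
  x*ₛ-shift f n = trans (sum-single (suc n) 1 _ (s≤s z≤n) others≡0) (ℤ.*-identityˡ (f n))
    where
    others≡0 : ∀ i → i ≤ suc n → ¬ i ≡ 1 → xₛ i * f (suc n ∸ i) ≡ 0ℤ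
    others≡0 zero          _ _   = refl
    others≡0 (suc zero)    _ i≢1 = ⊥-elim (i≢1 refl)
    others≡0 (suc (suc i)) _ _   = refl

  x^ₛ*ₛ-shift : ∀ m f j → (xₛ ^ₛ m *ₛ f) (m ℕ.+ j) ≡ f j
  x^ₛ*ₛ-shift zero    f j = *ₛ-identityˡ f j
  x^ₛ*ₛ-shift (suc m) f j =
    trans (*ₛ-assoc xₛ (xₛ ^ₛ m) f (suc (m ℕ.+ j)))
          (trans (x*ₛ-shift (xₛ ^ₛ m *ₛ f) (m ℕ.+ j)) (x^ₛ*ₛ-shift m f j))

  x*ₛ≐0⇒≐0 : ∀ f → xₛ *ₛ f ≐ 0ₛ → f ≐ 0ₛ
  x*ₛ≐0⇒≐0 f xf≐0 n = trans (sym (x*ₛ-shift f n)) (xf≐0 (suc n))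

  constₛ*ₛ≐0⇒≐0 : ∀ c f → ¬ c ≡ 0ℤ → constₛ c *ₛ f ≐ 0ₛ → f ≐ 0ₛ
  constₛ*ₛ≐0⇒≐0 c f c≢0 cf≐0 n = ℤ.*-cancelˡ-≡ c (f n) 0ℤ {{ℤ.≢-nonZero c≢0}}
    (trans (sym (constₛ-scale c f n)) (trans (cf≐0 n) (sym (ℤ.*-zeroʳ c))))

  unit*ₛ-cancel : ∀ a f → a 0 ≡ 1ℤ → a *ₛ f ≐ 0ₛ → f ≐ 0ₛ
  unit*ₛ-cancel a f a₀≡1 af≐0 = <-rec _ step
    where
    a₀f : ∀ n → f n ≡ a 0 * f n
    a₀f n = trans (sym (ℤ.*-identityˡ (f n))) (cong (_* f n) (sym a₀≡1))
    step : ∀ n → (∀ {m} → m < n → f m ≡ 0ℤ) → f n ≡ 0ℤ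
    step zero    _  = trans (a₀f 0) (af≐0 0)
    step (suc n) ih = begin
      f (suc n)                                           ≡⟨ a₀f (suc n) ⟩
      a 0 * f (suc n)                                     ≡⟨ ℤ.+-identityʳ _ ⟨
      a 0 * f (suc n) + 0ℤ                                ≡⟨ cong (λ z → a 0 * f (suc n) + z) higher≡0 ⟨
      a 0 * f (suc n) + sumℤ≤ n (λ i → a (suc i) * f (n ∸ i))
                                                        ≡⟨ sum-head n _ ⟨
      (a *ₛ f) (suc n)                                    ≡⟨ af≐0 (suc n) ⟩
      0ℤ                                                  ∎
      where
      open ≡-Reasoning
      higher≡0 : sumℤ≤ n (λ i → a (suc i) * f (n ∸ i)) ≡ 0ℤ
      higher≡0 = sum-zero n (λ i _ →
        trans (cong (a (suc i) *_) (ih (s≤s (ℕ.m∸n≤m n i)))) (ℤ.*-zeroʳ (a (suc i))))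

  OrderAtLeast : ℕ → Series → Set
  OrderAtLeast a f = ∀ j → j < a → f j ≡ 0ℤ

  order-0 : ∀ f → OrderAtLeast 0 f
  order-0 f j ()

  order-x : OrderAtLeast 1 xₛ
  order-x zero _            = refl
  order-x (suc j) (s≤s ())

  order-weaken : ∀ {a b f} → b ≤ a → OrderAtLeast a f → OrderAtLeast b f
  order-weaken b≤a ord j j<b = ord j (ℕ.<-≤-trans j<b b≤a)

  order-*ₛ : ∀ {f g} a b → OrderAtLeast a f → OrderAtLeast b g → OrderAtLeast (a ℕ.+ b) (f *ₛ g)
  order-*ₛ {f} {g} a b ord-f ord-g j j<a+b = sum-zero j term≡0
    where
    term≡0 : ∀ i → i ≤ j → f i * g (j ∸ i) ≡ 0ℤ
    term≡0 i i≤j with ℕ.<-≤-connex i a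
    ... | inj₁ i<a = trans (cong (_* g (j ∸ i)) (ord-f i i<a)) (ℤ.*-zeroˡ (g (j ∸ i)))
    ... | inj₂ a≤i = trans (cong (f i *_) (ord-g (j ∸ i) j∸i<b)) (ℤ.*-zeroʳ (f i))
      where
      j∸i<b : j ∸ i < b
      j∸i<b = ℕ.+-cancelˡ-< i (j ∸ i) b (subst (_< i ℕ.+ b) (sym (ℕ.m+[n∸m]≡n i≤j))
                (ℕ.<-≤-trans j<a+b (ℕ.+-monoˡ-≤ b a≤i)))

  order-*ₛˡ : ∀ {a f} g → OrderAtLeast a f → OrderAtLeast a (f *ₛ g)
  order-*ₛˡ {a} {f} g ord-f = order-weaken (ℕ.≤-reflexive (sym (ℕ.+-identityʳ a)))
    (order-*ₛ a 0 ord-f (order-0 g))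

  order-^ₛ : ∀ {f} m → OrderAtLeast 1 f → OrderAtLeast m (f ^ₛ m)
  order-^ₛ zero    ord-f = order-0 _
  order-^ₛ (suc m) ord-f = order-*ₛ 1 m ord-f (order-^ₛ m ord-f)

module Bivariate where

  open FiniteSums
  open PowerSeries
  open import Data.Nat as ℕ using (ℕ; zero; suc; _∸_; _≤_; z≤n; s≤s)
  open import Data.Nat.Induction using (<-rec)
  import Data.Nat.Properties as ℕ
  open import Data.Integer as ℤ using (ℤ; +_; 0ℤ; 1ℤ; _+_; _*_; -_)
  import Data.Integer.Properties as ℤ
  open import Data.Empty using (⊥-elim)
  open import Relation.Binary.PropositionalEquality
  open import Relation.Nullary using (¬_)
  open import Data.Integer.Tactic.RingSolver using (solve-∀)

  infix 9 [u^_]_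

  [u^_]_ : ℕ → Ser → Series
  ([u^ k ] f) n = f n k

  record UFree (f : Ser) : Set where
    constructor u-free
    field [u^suc]≡0 : ∀ n j → f n (suc j) ≡ 0ℤ

  open UFree public

  [u^0]-con : ∀ c → [u^ 0 ] con c ≐ constₛ c
  [u^0]-con c zero    = refl
  [u^0]-con c (suc n) = refl

  [u^suc]-con : ∀ c k → [u^ suc k ] con c ≐ 0ₛ
  [u^suc]-con c k zero    = refl
  [u^suc]-con c k (suc n) = refl

  [u^0]-X : [u^ 0 ] X ≐ xₛ
  [u^0]-X zero          = refl
  [u^0]-X (suc zero)    = refl
  [u^0]-X (suc (suc n)) = refl

  [u^0]-U : [u^ 0 ] U ≐ 0ₛ
  [u^0]-U zero    = refl
  [u^0]-U (suc n) = refl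

  [u^1]-U : [u^ 1 ] U ≐ 1ₛ
  [u^1]-U zero    = refl
  [u^1]-U (suc n) = refl

  [u^2+]-U : ∀ m → [u^ suc (suc m) ] U ≐ 0ₛ
  [u^2+]-U m zero    = refl
  [u^2+]-U m (suc n) = refl

  [u^0]-^ˢ : ∀ f m → [u^ 0 ] (f ^ˢ m) ≐ ([u^ 0 ] f) ^ₛ m
  [u^0]-^ˢ f zero    = [u^0]-con (+ 1)
  [u^0]-^ˢ f (suc m) = *ₛ-cong (≐-refl {[u^ 0 ] f}) ([u^0]-^ˢ f m)

  [u^0]-X^ˢ : ∀ m → [u^ 0 ] (X ^ˢ m) ≐ xₛ ^ₛ m
  [u^0]-X^ˢ m = ≐-trans ([u^0]-^ˢ X m) (^ₛ-cong [u^0]-X m)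

  ⊗-by-columns : ∀ f h n k → (f ⊗ h) n k ≡ sumℤ≤ k (λ j → ([u^ j ] f *ₛ [u^ (k ∸ j) ] h) n)
  ⊗-by-columns f h n k = sum-comm n k _

  ⊗-by-columnsʳ : ∀ f h n k → (f ⊗ h) n k ≡ sumℤ≤ k (λ j → ([u^ (k ∸ j) ] f *ₛ [u^ j ] h) n)
  ⊗-by-columnsʳ f h n k = trans (⊗-by-columns f h n k) (trans (sum-reverse k _)
    (sum-cong k (λ j j≤k → cong (λ i → ([u^ (k ∸ j) ] f *ₛ [u^ i ] h) n) (ℕ.m∸[m∸n]≡n j≤k))))

  [u^]-⊗-UFreeˡ : ∀ f h → UFree f → ∀ k → [u^ k ] (f ⊗ h) ≐ [u^ 0 ] f *ₛ [u^ k ] h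
  [u^]-⊗-UFreeˡ f h (u-free free-f) k n = sum-ext n (λ i → sum-single k 0 _ z≤n (λ j _ → term≡0 i j))
    where
    term≡0 : ∀ i j → ¬ j ≡ 0 → f i j * h (n ∸ i) (k ∸ j) ≡ 0ℤ
    term≡0 i zero    j≢0 = ⊥-elim (j≢0 refl)
    term≡0 i (suc j) _   =
      trans (cong (_* h (n ∸ i) (k ∸ suc j)) (free-f i j)) (ℤ.*-zeroˡ (h (n ∸ i) (k ∸ suc j)))

  [u^]-⊗-UFreeʳ : ∀ f h → UFree h → ∀ k → [u^ k ] (f ⊗ h) ≐ [u^ k ] f *ₛ [u^ 0 ] h
  [u^]-⊗-UFreeʳ f h (u-free free-h) k n = sum-ext n (λ i →
    trans (sum-single k k _ ℕ.≤-refl (term≡0 i))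
          (cong (λ j → f i k * h (n ∸ i) j) (ℕ.n∸n≡0 k)))
    where
    term≡0 : ∀ i j → j ≤ k → ¬ j ≡ k → f i j * h (n ∸ i) (k ∸ j) ≡ 0ℤ
    term≡0 i j j≤k j≢k = trans (cong (f i j *_) h≡0) (ℤ.*-zeroʳ (f i j))
      where
      h≡0 : h (n ∸ i) (k ∸ j) ≡ 0ℤ
      h≡0 rewrite ℕ.+-∸-assoc 1 (ℕ.≤∧≢⇒< j≤k j≢k) = free-h (n ∸ i) (k ∸ suc j)

  UFree-con : ∀ c → UFree (con c)
  UFree-con c = u-free λ where
    zero    j → refl
    (suc n) j → refl

  UFree-X : UFree X
  UFree-X = u-free λ where
    zero          j → refl
    (suc zero)    j → refl
    (suc (suc n)) j → refl

  UFree-⊕ : ∀ {f h} → UFree f → UFree h → UFree (f ⊕ h)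
  UFree-⊕ (u-free free-f) (u-free free-h) = u-free λ n j → cong₂ _+_ (free-f n j) (free-h n j)

  UFree-⊖ : ∀ {f h} → UFree f → UFree h → UFree (f ⊖ h)
  UFree-⊖ (u-free free-f) (u-free free-h) = u-free λ n j → cong₂ (λ a b → a + - b) (free-f n j) (free-h n j)

  UFree-⊗ : ∀ {f h} → UFree f → UFree h → UFree (f ⊗ h)
  UFree-⊗ {f} {h} (u-free free-f) (u-free free-h) = u-free λ n j →
    sum-zero n (λ i _ → sum-zero (suc j) (λ j′ _ → term≡0 n j i j′))
    where
    term≡0 : ∀ n j i j′ → f i j′ * h (n ∸ i) (suc j ∸ j′) ≡ 0ℤ
    term≡0 n j i zero     = trans (cong (f i 0 *_) (free-h (n ∸ i) j)) (ℤ.*-zeroʳ (f i 0))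
    term≡0 n j i (suc j′) =
      trans (cong (_* h (n ∸ i) (j ∸ j′)) (free-f i j′)) (ℤ.*-zeroˡ (h (n ∸ i) (j ∸ j′)))

  UFree-^ˢ : ∀ {f} m → UFree f → UFree (f ^ˢ m)
  UFree-^ˢ zero    free-f = UFree-con (+ 1)
  UFree-^ˢ (suc m) free-f = UFree-⊗ free-f (UFree-^ˢ m free-f)

  ⊗U-zero : ∀ f n → (f ⊗ U) n 0 ≡ 0ℤ
  ⊗U-zero f n = zeroʳ⇒*ₛ≐0 ([u^ 0 ] f) [u^0]-U n

  ⊗U-shift : ∀ f n k → (f ⊗ U) n (suc k) ≡ f n k
  ⊗U-shift f n k = begin
    (f ⊗ U) n (suc k)
      ≡⟨ ⊗-by-columnsʳ f U n (suc k) ⟩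
    sumℤ≤ (suc k) (λ j → ([u^ (suc k ∸ j) ] f *ₛ [u^ j ] U) n)
      ≡⟨ sum-single (suc k) 1 _ (s≤s z≤n) term≡0 ⟩
    ([u^ k ] f *ₛ [u^ 1 ] U) n
      ≡⟨ *ₛ-cong (≐-refl {[u^ k ] f}) [u^1]-U n ⟩
    ([u^ k ] f *ₛ 1ₛ) n
      ≡⟨ trans (*ₛ-comm ([u^ k ] f) 1ₛ n) (*ₛ-identityˡ ([u^ k ] f) n) ⟩
    f n k ∎
    where
    open ≡-Reasoning
    term≡0 : ∀ j → j ≤ suc k → ¬ j ≡ 1 → ([u^ (suc k ∸ j) ] f *ₛ [u^ j ] U) n ≡ 0ℤ
    term≡0 zero          _ _   = zeroʳ⇒*ₛ≐0 ([u^ suc k ] f) [u^0]-U n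
    term≡0 (suc zero)    _ j≢1 = ⊥-elim (j≢1 refl)
    term≡0 (suc (suc j)) _ _   = zeroʳ⇒*ₛ≐0 ([u^ (k ∸ suc j) ] f) ([u^2+]-U j) n

  U⊗-zero : ∀ h n → (U ⊗ h) n 0 ≡ 0ℤ
  U⊗-zero h n = zeroˡ⇒*ₛ≐0 ([u^ 0 ] h) [u^0]-U n

  U⊗-shift : ∀ h n k → (U ⊗ h) n (suc k) ≡ h n k
  U⊗-shift h n k = begin
    (U ⊗ h) n (suc k)
      ≡⟨ ⊗-by-columns U h n (suc k) ⟩
    sumℤ≤ (suc k) (λ j → ([u^ j ] U *ₛ [u^ (suc k ∸ j) ] h) n)
      ≡⟨ sum-single (suc k) 1 _ (s≤s z≤n) term≡0 ⟩
    ([u^ 1 ] U *ₛ [u^ k ] h) n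
      ≡⟨ trans (*ₛ-cong [u^1]-U (≐-refl {[u^ k ] h}) n) (*ₛ-identityˡ ([u^ k ] h) n) ⟩
    h n k ∎
    where
    open ≡-Reasoning
    term≡0 : ∀ j → j ≤ suc k → ¬ j ≡ 1 → ([u^ j ] U *ₛ [u^ (suc k ∸ j) ] h) n ≡ 0ℤ
    term≡0 zero          _ _   = zeroˡ⇒*ₛ≐0 ([u^ suc k ] h) [u^0]-U n
    term≡0 (suc zero)    _ j≢1 = ⊥-elim (j≢1 refl)
    term≡0 (suc (suc j)) _ _   = zeroˡ⇒*ₛ≐0 ([u^ (k ∸ suc j) ] h) ([u^2+]-U j) n

  square-UFree⇒UFree : ∀ f → f 0 0 ≡ 1ℤ → UFree (f ⊗ f) → UFree f
  square-UFree⇒UFree f f₀₀≡1 (u-free free-f²) =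
    u-free λ n j → <-rec (λ j → [u^ suc j ] f ≐ 0ₛ) step j n
    where
    step : ∀ j → (∀ {i} → i ℕ.< j → [u^ suc i ] f ≐ 0ₛ) → [u^ suc j ] f ≐ 0ₛ
    step j ih = unit*ₛ-cancel ([u^ 0 ] f) c f₀₀≡1
      (constₛ*ₛ≐0⇒≐0 (+ 2) ([u^ 0 ] f *ₛ c) (λ ()) twice)
      where
      c = [u^ suc j ] f
      middle : ∀ n → sumℤ≤ j (λ i → ([u^ suc i ] f *ₛ [u^ (j ∸ i) ] f) n) ≡ (c *ₛ [u^ 0 ] f) n
      middle n = trans (sum-single j j _ ℕ.≤-refl (λ i i≤j i≢j →
                          zeroˡ⇒*ₛ≐0 ([u^ (j ∸ i) ] f) (ih (ℕ.≤∧≢⇒< i≤j i≢j)) n))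
                       (cong (λ m → (c *ₛ [u^ m ] f) n) (ℕ.n∸n≡0 j))
      twice : ∀ n → (constₛ (+ 2) *ₛ ([u^ 0 ] f *ₛ c)) n ≡ 0ℤ
      twice n = begin
        (constₛ (+ 2) *ₛ ([u^ 0 ] f *ₛ c)) n
          ≡⟨ constₛ-scale (+ 2) ([u^ 0 ] f *ₛ c) n ⟩
        + 2 * ([u^ 0 ] f *ₛ c) n
          ≡⟨ double (([u^ 0 ] f *ₛ c) n) ⟩
        ([u^ 0 ] f *ₛ c) n + ([u^ 0 ] f *ₛ c) n
          ≡⟨ cong (λ z → ([u^ 0 ] f *ₛ c) n + z) (trans (*ₛ-comm ([u^ 0 ] f) c n) (sym (middle n))) ⟩
        ([u^ 0 ] f *ₛ c) n + sumℤ≤ j (λ i → ([u^ suc i ] f *ₛ [u^ (j ∸ i) ] f) n)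
          ≡⟨ sum-head j _ ⟨
        sumℤ≤ (suc j) (λ i → ([u^ i ] f *ₛ [u^ (suc j ∸ i) ] f) n)
          ≡⟨ ⊗-by-columns f f n (suc j) ⟨
        (f ⊗ f) n (suc j)
          ≡⟨ free-f² n j ⟩
        0ℤ ∎
        where
        open ≡-Reasoning
        double : ∀ a → + 2 * a ≡ a + a
        double = solve-∀

  UFree-⊗⁻ : ∀ a f → UFree a → (∀ g → [u^ 0 ] a *ₛ g ≐ 0ₛ → g ≐ 0ₛ) →
    UFree (a ⊗ f) → UFree f
  UFree-⊗⁻ a f free-a cancel-a (u-free free-af) = u-free λ n j → cancel-a ([u^ suc j ] f)
    (λ m → trans (sym ([u^]-⊗-UFreeˡ a f free-a (suc j) m)) (free-af m j)) n

  ⊗-two-columnsʳ : ∀ f h → (∀ j → [u^ suc (suc j) ] h ≐ 0ₛ) → ∀ n k →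
    (f ⊗ h) n (suc k) ≡ ([u^ suc k ] f *ₛ [u^ 0 ] h) n + ([u^ k ] f *ₛ [u^ 1 ] h) n
  ⊗-two-columnsʳ f h h-columns n k = trans (⊗-by-columnsʳ f h n (suc k)) (sum-truncate 1 k _ λ where
    (suc zero) (s≤s ())
    (suc (suc j)) _ → zeroʳ⇒*ₛ≐0 ([u^ (k ∸ suc j) ] f) (h-columns j) n)

  ⊗-three-columnsˡ : ∀ a f → (∀ j → [u^ suc (suc (suc j)) ] a ≐ 0ₛ) → ∀ n k →
    (a ⊗ f) n (suc (suc k)) ≡
    ([u^ 0 ] a *ₛ [u^ suc (suc k) ] f) n + ([u^ 1 ] a *ₛ [u^ suc k ] f) n + ([u^ 2 ] a *ₛ [u^ k ] f) n
  ⊗-three-columnsˡ a f a-columns n k = trans (⊗-by-columns a f n (suc (suc k))) (sum-truncate 2 k _ λ where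
    (suc zero)          (s≤s ())
    (suc (suc zero))    (s≤s (s≤s ()))
    (suc (suc (suc j))) _ → zeroˡ⇒*ₛ≐0 ([u^ (k ∸ suc j) ] f) (a-columns j) n)

module Polyominoes where

  open import Data.Nat as ℕ using (ℕ; zero; suc; _+_; _∸_; _≤_; _<_; z≤n; s≤s)
  import Data.Nat.Properties as ℕ
  open import Data.Product using (_×_; _,_; Σ-syntax; proj₁; proj₂)
  open import Data.Unit using (tt)
  open import Data.Empty using (⊥; ⊥-elim)
  open import Data.Sum using (inj₁; inj₂)
  open import Data.List using (List; []; _∷_; _++_; map; length)
  import Data.List.Properties as List
  open import Data.List.Membership.Propositional using (_∈_)
  open import Data.List.Membership.Propositional.Properties
    using (∈-++⁻; ∈-++⁺ˡ; ∈-++⁺ʳ; ∈-map⁻; ∈-map⁺)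
  open import Data.List.Membership.Propositional.Properties.WithK using (unique∧set⇒bag)
  open import Data.List.Relation.Unary.Any using (here)
  open import Data.List.Relation.Unary.All using ([])
  open import Data.List.Relation.Unary.AllPairs using ([]; _∷_)
  open import Data.List.Relation.Unary.Unique.Propositional using (Unique)
  import Data.List.Relation.Unary.Unique.Propositional.Properties as Unique
  open import Data.List.Relation.Binary.BagAndSetEquality using (∼bag⇒↭)
  open import Data.List.Relation.Binary.Permutation.Propositional.Properties using (↭-length)
  open import Function.Bundles using (mk⇔; Equivalence)
  open import Relation.Binary.PropositionalEquality
  open import Relation.Nullary using (¬_; yes; no)

  shiftRight : List Row → List Row
  shiftRight []              = []
  shiftRight ((s , e) ∷ rows) = (suc s , suc e) ∷ shiftRight rows

  addColumn : List Row → List Row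
  addColumn []              = []
  addColumn ((s , e) ∷ rows) = (s , suc e) ∷ shiftRight rows

  addBottomRow : ℕ → List Row → List Row
  addBottomRow e P = (0 , e) ∷ shiftRight P

  concatUpTo : {A : Set} → ℕ → (ℕ → List A) → List A
  concatUpTo zero    f = []
  concatUpTo (suc L) f = concatUpTo L f ++ f L

  sumUpTo : ℕ → (ℕ → ℕ) → ℕ
  sumUpTo zero    f = 0
  sumUpTo (suc L) f = sumUpTo L f + f L

  StanleyWith : ℕ → ℕ → List Row → Set
  StanleyWith n k P = Stanley P × sper P ≡ n × first P ≡ k

  -- The cases s₁ ≠ 1 (addColumn, sper grows by 1) and s₁ = 1 (addBottomRow, sper grows by 2).
  stanleys : ℕ → ℕ → List (List Row)
  stanleys (suc (suc n)) (suc (suc k)) =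
    map addColumn (stanleys (suc n) (suc k)) ++
    concatUpTo n (λ i → map (addBottomRow (suc k)) (stanleys n (suc (suc (k + i)))))
  stanleys (suc (suc zero)) (suc zero) = ((0 , 0) ∷ []) ∷ []
  stanleys _ _ = []

  sumUpTo-ext : ∀ L {f g : ℕ → ℕ} → (∀ i → f i ≡ g i) → sumUpTo L f ≡ sumUpTo L g
  sumUpTo-ext zero    f≡g = refl
  sumUpTo-ext (suc L) f≡g = cong₂ _+_ (sumUpTo-ext L f≡g) (f≡g L)

  length-concatUpTo : {A : Set} → ∀ L (f : ℕ → List A) →
    length (concatUpTo L f) ≡ sumUpTo L (λ i → length (f i))
  length-concatUpTo zero    f = refl
  length-concatUpTo (suc L) f =
    trans (List.length-++ (concatUpTo L f)) (cong (_+ length (f L)) (length-concatUpTo L f))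

  ∈-concatUpTo⁻ : {A : Set} → ∀ L (f : ℕ → List A) {x} → x ∈ concatUpTo L f →
    Σ[ i ∈ ℕ ] (i < L × x ∈ f i)
  ∈-concatUpTo⁻ (suc L) f x∈ with ∈-++⁻ (concatUpTo L f) x∈
  ... | inj₂ x∈fL = L , ℕ.≤-refl , x∈fL
  ... | inj₁ x∈xs with ∈-concatUpTo⁻ L f x∈xs
  ...   | i , i<L , x∈fi = i , ℕ.m<n⇒m<1+n i<L , x∈fi

  ∈-concatUpTo⁺ : {A : Set} → ∀ L (f : ℕ → List A) {x} i → i < L → x ∈ f i → x ∈ concatUpTo L f
  ∈-concatUpTo⁺ (suc L) f i i<1+L x∈fi with i ℕ.≟ L
  ... | yes refl = ∈-++⁺ʳ (concatUpTo L f) x∈fi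
  ... | no  i≢L  = ∈-++⁺ˡ (∈-concatUpTo⁺ L f i (ℕ.≤∧≢⇒< (ℕ.≤-pred i<1+L) i≢L) x∈fi)

  concatUpTo-unique : {A : Set} → ∀ L (f : ℕ → List A) → (∀ i → Unique (f i)) →
    (∀ i j x → x ∈ f i → x ∈ f j → i ≡ j) → Unique (concatUpTo L f)
  concatUpTo-unique zero    f unique-f disjoint = []
  concatUpTo-unique (suc L) f unique-f disjoint =
    Unique.++⁺ (concatUpTo-unique L f unique-f disjoint) (unique-f L) λ (x∈xs , x∈fL) → apart x∈xs x∈fL
    where
    apart : ∀ {x} → x ∈ concatUpTo L f → x ∈ f L → ⊥
    apart x∈xs x∈fL with ∈-concatUpTo⁻ L f x∈xs
    ... | i , i<L , x∈fi = ℕ.<-irrefl (disjoint i L _ x∈fi x∈fL) i<L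

  length-stanleys : ∀ n k → length (stanleys (suc (suc n)) (suc (suc k))) ≡
    length (stanleys (suc n) (suc k)) + sumUpTo n (λ i → length (stanleys n (suc (suc (k + i)))))
  length-stanleys n k = trans (List.length-++ (map addColumn (stanleys (suc n) (suc k))))
    (cong₂ _+_ (List.length-map addColumn (stanleys (suc n) (suc k)))
      (trans (length-concatUpTo n _)
        (sumUpTo-ext n (λ i → List.length-map (addBottomRow (suc k)) (stanleys n (suc (suc (k + i))))))))

  chain-shiftRight : ∀ s e rows → ChainFrom (s , e) rows → ChainFrom (suc s , suc e) (shiftRight rows)
  chain-shiftRight s e []                _ = tt
  chain-shiftRight s e ((s′ , e′) ∷ rows) (a , b , c , d , chain) =
    s≤s a , s≤s b , s≤s c , s≤s d , chain-shiftRight s′ e′ rows chain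

  chain-shiftRight⁻ : ∀ s e rows → ChainFrom (suc s , suc e) rows →
    Σ[ rows′ ∈ List Row ] (rows ≡ shiftRight rows′ × ChainFrom (s , e) rows′)
  chain-shiftRight⁻ s e [] _ = [] , refl , tt
  chain-shiftRight⁻ s e ((suc s′ , suc e′) ∷ rows) (s≤s a , s≤s b , s≤s c , s≤s d , chain)
    with chain-shiftRight⁻ s′ e′ rows chain
  ... | rows′ , refl , chain′ = (s′ , e′) ∷ rows′ , refl , a , b , c , d , chain′

  chain-addColumn : ∀ s e rows → ChainFrom (s , e) rows → ChainFrom (s , suc e) (shiftRight rows)
  chain-addColumn s e []                _ = tt
  chain-addColumn s e ((s′ , e′) ∷ rows) (a , b , c , d , chain) =
    ℕ.m<n⇒m<1+n a , s≤s b , s≤s c , s≤s d , chain-shiftRight s′ e′ rows chain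

  lastEnd-shiftRight : ∀ a b e rows → lastEnd (a , suc e) (shiftRight rows) ≡ suc (lastEnd (b , e) rows)
  lastEnd-shiftRight a b e []                = refl
  lastEnd-shiftRight a b e ((s′ , e′) ∷ rows) = lastEnd-shiftRight (suc s′) s′ e′ rows

  length-shiftRight : ∀ rows → length (shiftRight rows) ≡ length rows
  length-shiftRight []         = refl
  length-shiftRight (_ ∷ rows) = cong suc (length-shiftRight rows)

  end≤lastEnd : ∀ s e rows → ChainFrom (s , e) rows → e ≤ lastEnd (s , e) rows
  end≤lastEnd s e []                _                 = ℕ.≤-refl
  end≤lastEnd s e ((s′ , e′) ∷ rows) (_ , _ , e<e′ , _ , chain) =
    ℕ.≤-trans (ℕ.<⇒≤ e<e′) (end≤lastEnd s′ e′ rows chain)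

  sper-addColumn : ∀ e rows → sper ((0 , suc e) ∷ shiftRight rows) ≡ suc (sper ((0 , e) ∷ rows))
  sper-addColumn e rows rewrite lastEnd-shiftRight 0 0 e rows | length-shiftRight rows = refl

  sper-addBottomRow : ∀ k e rows →
    sper ((0 , k) ∷ (1 , suc e) ∷ shiftRight rows) ≡ suc (suc (sper ((0 , e) ∷ rows)))
  sper-addBottomRow k e rows rewrite lastEnd-shiftRight 1 0 e rows | length-shiftRight rows =
    cong (λ m → suc (suc m)) (ℕ.+-suc (lastEnd (0 , e) rows) (suc (length rows)))

  first<sper : ∀ e rows → ChainFrom (0 , e) rows → suc e < sper ((0 , e) ∷ rows)
  first<sper e rows chain = s≤s (ℕ.≤-trans (s≤s (end≤lastEnd 0 e rows chain))
    (ℕ.≤-trans (s≤s (ℕ.m≤m+n _ (length rows))) (ℕ.≤-reflexive (sym (ℕ.+-suc _ (length rows))))))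

  addColumn-sound : ∀ n k P →
    StanleyWith (suc n) (suc k) P → StanleyWith (suc (suc n)) (suc (suc k)) (addColumn P)
  addColumn-sound n k ((.0 , e) ∷ rows) ((refl , _ , chain) , sper≡ , first≡) =
    (refl , z≤n , chain-addColumn 0 e rows chain) ,
    trans (sper-addColumn e rows) (cong suc sper≡) , cong suc first≡

  addBottomRow-sound : ∀ n k i P → StanleyWith n (suc (suc (k + i))) P →
    StanleyWith (suc (suc n)) (suc (suc k)) (addBottomRow (suc k) P)
  addBottomRow-sound n k i ((.0 , .(suc (k + i))) ∷ rows) ((refl , _ , chain) , sper≡ , refl) =
    (refl , z≤n , s≤s z≤n , s≤s z≤n , s≤s (s≤s (ℕ.m≤m+n k i)) , s≤s z≤n ,
     chain-shiftRight 0 (suc (k + i)) rows chain) ,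
    trans (sper-addBottomRow (suc k) (suc (k + i)) rows) (cong (λ m → suc (suc m)) sper≡) , refl

  stanleys-sound : ∀ n k P → P ∈ stanleys n k → StanleyWith n k P
  stanleys-sound (suc (suc n)) (suc (suc k)) P P∈ with ∈-++⁻ (map addColumn (stanleys (suc n) (suc k))) P∈
  ... | inj₁ P∈₁ with ∈-map⁻ addColumn P∈₁
  ...   | P′ , P′∈ , refl = addColumn-sound n k P′ (stanleys-sound (suc n) (suc k) P′ P′∈)
  stanleys-sound (suc (suc n)) (suc (suc k)) P P∈ | inj₂ P∈₂ with ∈-concatUpTo⁻ n _ P∈₂
  ... | i , _ , P∈ᵢ with ∈-map⁻ (addBottomRow (suc k)) P∈ᵢ
  ...   | P′ , P′∈ , refl = addBottomRow-sound n k i P′ (stanleys-sound n (suc (suc (k + i))) P′ P′∈)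
  stanleys-sound (suc (suc zero)) (suc zero) P (here refl) = (refl , z≤n , tt) , refl , refl

  ∈-addBottomRow-part : ∀ n k e P → k < e → e < n → P ∈ stanleys n (suc e) →
    addBottomRow (suc k) P ∈ concatUpTo n (λ i → map (addBottomRow (suc k)) (stanleys n (suc (suc (k + i)))))
  ∈-addBottomRow-part n k e P k<e e<n P∈ =
    ∈-concatUpTo⁺ n _ (e ∸ suc k) (ℕ.≤-<-trans (ℕ.m∸n≤m e (suc k)) e<n)
      (∈-map⁺ (addBottomRow (suc k))
        (subst (λ m → P ∈ stanleys n m) (cong suc (sym (ℕ.m+[n∸m]≡n k<e))) P∈))

  stanleys-complete : ∀ n k e rows → ChainFrom (0 , e) rows → sper ((0 , e) ∷ rows) ≡ n → suc e ≡ k →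
    ((0 , e) ∷ rows) ∈ stanleys n k
  stanleys-complete zero _ _ _ _ () _
  stanleys-complete (suc zero) _ e rows _ sper≡1 _ =
    ⊥-elim (ℕ.1+n≢0 (trans (sym (ℕ.+-suc (lastEnd (0 , e) rows) (length rows))) (ℕ.suc-injective sper≡1)))
  stanleys-complete (suc (suc n)) (suc zero) zero [] _ refl refl = here refl
  stanleys-complete (suc (suc n)) (suc zero) zero ((_ , _) ∷ _) (0<s₁ , s₁≤0 , _) _ refl =
    ⊥-elim (ℕ.<-irrefl refl (ℕ.<-≤-trans 0<s₁ s₁≤0))
  stanleys-complete (suc (suc n)) (suc (suc k)) .(suc k) [] _ sper≡ refl =
    ∈-++⁺ˡ (∈-map⁺ addColumn
      (stanleys-complete (suc n) (suc k) k [] tt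
        (ℕ.suc-injective (trans (sym (sper-addColumn k [])) sper≡)) refl))
  stanleys-complete (suc (suc n)) (suc (suc k)) .(suc k) ((suc s₁ , suc e₁) ∷ rows)
                    (s≤s z≤n , s≤s s₁≤k , s≤s k<e₁ , s≤s s₁≤e₁ , chain) sper≡ refl
    with chain-shiftRight⁻ s₁ e₁ rows chain
  ... | rows′ , refl , chain′ with s₁
  ...   | zero = ∈-++⁺ʳ (map addColumn (stanleys (suc n) (suc k)))
    (∈-addBottomRow-part n k e₁ _ k<e₁ e₁<n
      (stanleys-complete n (suc e₁) e₁ rows′ chain′ sper′≡ refl))
    where
    sper′≡ : sper ((0 , e₁) ∷ rows′) ≡ n
    sper′≡ = ℕ.suc-injective (ℕ.suc-injective (trans (sym (sper-addBottomRow (suc k) e₁ rows′)) sper≡))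
    e₁<n : e₁ < n
    e₁<n = ℕ.<-trans (ℕ.n<1+n e₁) (subst (suc e₁ <_) sper′≡ (first<sper e₁ rows′ chain′))
  ...   | suc s =
    ∈-++⁺ˡ (∈-map⁺ addColumn
      (stanleys-complete (suc n) (suc k) k ((suc s , e₁) ∷ rows′)
        (s≤s z≤n , s₁≤k , k<e₁ , s₁≤e₁ , chain′)
        (ℕ.suc-injective (trans (sym (sper-addColumn k ((suc s , e₁) ∷ rows′))) sper≡)) refl))

  shiftRight-injective : ∀ {P Q} → shiftRight P ≡ shiftRight Q → P ≡ Q
  shiftRight-injective {[]}          {[]}          _  = refl
  shiftRight-injective {(a , b) ∷ P} {(c , d) ∷ Q} eq with List.∷-injective eq
  ... | refl , P≡Q = cong ((a , b) ∷_) (shiftRight-injective P≡Q)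

  addColumn-injective : ∀ {P Q} → addColumn P ≡ addColumn Q → P ≡ Q
  addColumn-injective {[]}          {[]}          _  = refl
  addColumn-injective {(a , b) ∷ P} {(c , d) ∷ Q} eq with List.∷-injective eq
  ... | refl , P≡Q = cong ((a , b) ∷_) (shiftRight-injective P≡Q)

  addBottomRow-injective : ∀ e {P Q} → addBottomRow e P ≡ addBottomRow e Q → P ≡ Q
  addBottomRow-injective e eq = shiftRight-injective (proj₂ (List.∷-injective eq))

  chain-into-Stanley : ∀ {s e} Q → ChainFrom (s , e) Q → ¬ Stanley Q
  chain-into-Stanley ((.0 , _) ∷ _) (() , _) (refl , _)

  addColumn≢addBottomRow : ∀ P e Q → Stanley P → Stanley Q → ¬ addColumn P ≡ addBottomRow e Q
  addColumn≢addBottomRow ((.0 , _) ∷ rows) e Q (refl , _ , chain) stanley-Q eq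
    with shiftRight-injective (proj₂ (List.∷-injective eq))
  ... | refl = chain-into-Stanley rows chain stanley-Q

  stanleys-unique : ∀ n k → Unique (stanleys n k)
  stanleys-unique (suc (suc n)) (suc (suc k)) =
    Unique.++⁺ (Unique.map⁺ addColumn-injective (stanleys-unique (suc n) (suc k)))
      (concatUpTo-unique n _ (λ i → Unique.map⁺ (addBottomRow-injective (suc k)) (stanleys-unique n _))
        pieces-disjoint)
      (λ (x∈left , x∈right) → left-right-disjoint x∈left x∈right)
    where
    pieces-disjoint : ∀ i j x → x ∈ map (addBottomRow (suc k)) (stanleys n (suc (suc (k + i)))) →
      x ∈ map (addBottomRow (suc k)) (stanleys n (suc (suc (k + j)))) → i ≡ j
    pieces-disjoint i j x x∈ᵢ x∈ⱼ
      with ∈-map⁻ (addBottomRow (suc k)) x∈ᵢ | ∈-map⁻ (addBottomRow (suc k)) x∈ⱼ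
    ... | P , P∈ , refl | Q , Q∈ , eq with addBottomRow-injective (suc k) eq
    ...   | refl = ℕ.+-cancelˡ-≡ k i j
      (ℕ.suc-injective (ℕ.suc-injective (trans (sym (first≡ _ P P∈)) (first≡ _ P Q∈))))
      where
      first≡ : ∀ k′ P → P ∈ stanleys n k′ → first P ≡ k′
      first≡ k′ P P∈ = proj₂ (proj₂ (stanleys-sound n k′ P P∈))
    left-right-disjoint : ∀ {x} → x ∈ map addColumn (stanleys (suc n) (suc k)) →
      x ∈ concatUpTo n (λ i → map (addBottomRow (suc k)) (stanleys n (suc (suc (k + i))))) → ⊥
    left-right-disjoint x∈left x∈right with ∈-map⁻ addColumn x∈left | ∈-concatUpTo⁻ n _ x∈right
    ... | P , P∈ , refl | i , _ , x∈ᵢ with ∈-map⁻ (addBottomRow (suc k)) x∈ᵢ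
    ...   | Q , Q∈ , eq = addColumn≢addBottomRow P (suc k) Q
      (proj₁ (stanleys-sound (suc n) (suc k) P P∈)) (proj₁ (stanleys-sound n _ Q Q∈)) eq
  stanleys-unique (suc (suc zero)) (suc zero) = [] ∷ []
  stanleys-unique zero                _          = []
  stanleys-unique (suc zero)          _          = []
  stanleys-unique (suc (suc n))       zero       = []
  stanleys-unique (suc (suc (suc n))) (suc zero) = []

  IsCount⇒length : ∀ n k c → IsCount n k c → c ≡ length (stanleys n k)
  IsCount⇒length n k c (L , unique-L , L-spec , refl) =
    ↭-length (∼bag⇒↭ (unique∧set⇒bag unique-L (stanleys-unique n k) λ {P} → mk⇔
      (λ P∈L → stanleys-complete′ P (Equivalence.to (L-spec P) P∈L))
      (λ P∈ → Equivalence.from (L-spec P) (stanleys-sound n k P P∈))))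
    where
    stanleys-complete′ : ∀ P → StanleyWith n k P → P ∈ stanleys n k
    stanleys-complete′ ((.0 , e) ∷ rows) ((refl , _ , chain) , sper≡ , first≡) =
      stanleys-complete n k e rows chain sper≡ first≡

module Ballot where

  open import Data.Nat as ℕ using (ℕ; zero; suc; _<_; z≤n; s≤s)
  import Data.Nat.Properties as ℕ
  open import Data.Nat.Combinatorics using (_C_; nCk+nC[k+1]≡[n+1]C[k+1]; nCk≡nC[n∸k])
  open import Data.Integer as ℤ using (ℤ; +_; 0ℤ; 1ℤ; _+_; _*_; -_; _-_)
  import Data.Integer.Properties as ℤ
  open import Data.Integer.Tactic.RingSolver as ℤ-Solver using ()
  import Data.Nat.Tactic.RingSolver as ℕ-Solver
  open import Relation.Binary.PropositionalEquality

  choose : ℕ → ℕ → ℕ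
  choose n       zero    = 1
  choose zero    (suc k) = 0
  choose (suc n) (suc k) = choose n k ℕ.+ choose n (suc k)

  choose≡C : ∀ n k → choose n k ≡ n C k
  choose≡C n       zero    = refl
  choose≡C zero    (suc k) = refl
  choose≡C (suc n) (suc k) =
    trans (cong₂ ℕ._+_ (choose≡C n k) (choose≡C n (suc k))) (nCk+nC[k+1]≡[n+1]C[k+1] n k)

  choose-< : ∀ n k → n < k → choose n k ≡ 0
  choose-< zero    (suc k) _         = refl
  choose-< (suc n) (suc k) (s≤s n<k) = cong₂ ℕ._+_ (choose-< n k n<k) (choose-< n (suc k) (ℕ.m<n⇒m<1+n n<k))

  choose-diag : ∀ n → choose n n ≡ 1
  choose-diag zero    = refl
  choose-diag (suc n) = cong₂ ℕ._+_ (choose-diag n) (choose-< n (suc n) ℕ.≤-refl)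

  choose-1 : ∀ n → choose n 1 ≡ n
  choose-1 zero    = refl
  choose-1 (suc n) = cong suc (choose-1 n)

  choose-absorb : ∀ a j → suc j ℕ.* choose (suc a) (suc j) ≡ suc a ℕ.* choose a j
  choose-absorb zero    zero    = refl
  choose-absorb zero    (suc j) =
    trans (cong (suc (suc j) ℕ.*_) (choose-< 1 (suc (suc j)) (s≤s (s≤s z≤n)))) (ℕ.*-zeroʳ (suc (suc j)))
  choose-absorb (suc a) zero    =
    cong suc (trans (ℕ.+-identityʳ _) (trans (choose-1 (suc a)) (sym (ℕ.*-identityʳ (suc a)))))
  choose-absorb (suc a) (suc j) = begin
    suc (suc j) ℕ.* (u ℕ.+ v)
      ≡⟨ ℕ.*-distribˡ-+ (suc (suc j)) u v ⟩
    (u ℕ.+ suc j ℕ.* u) ℕ.+ suc (suc j) ℕ.* v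
      ≡⟨ cong₂ (λ y z → (u ℕ.+ y) ℕ.+ z) (choose-absorb a j) (choose-absorb a (suc j)) ⟩
    (u ℕ.+ suc a ℕ.* c₁) ℕ.+ suc a ℕ.* c₂
      ≡⟨ regroup a u c₁ c₂ ⟩
    u ℕ.+ suc a ℕ.* (c₁ ℕ.+ c₂) ∎
    where
    open ≡-Reasoning
    c₁ = choose a j
    c₂ = choose a (suc j)
    u  = c₁ ℕ.+ c₂
    v  = choose (suc a) (suc (suc j))
    regroup : ∀ a u c₁ c₂ →
      (u ℕ.+ suc a ℕ.* c₁) ℕ.+ suc a ℕ.* c₂ ≡ u ℕ.+ suc a ℕ.* (c₁ ℕ.+ c₂)
    regroup = ℕ-Solver.solve-∀

  choose-middle : ∀ M → choose (suc (M ℕ.+ M)) (suc M) ≡ choose (suc (M ℕ.+ M)) M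
  choose-middle M = trans (choose≡C _ (suc M)) (trans (nCk≡nC[n∸k] (s≤s (ℕ.m≤m+n M M)))
    (trans (cong (suc (M ℕ.+ M) C_) (ℕ.m+n∸m≡n M M)) (sym (choose≡C _ M))))

  choose-diff : ℕ → ℕ → ℤ
  choose-diff a j = + choose a (suc j) - + choose a j

  choose-diff-pascal : ∀ a j → choose-diff (suc a) (suc j) ≡ choose-diff a (suc j) + choose-diff a j
  choose-diff-pascal a j = begin
    + (choose a (suc j) ℕ.+ choose a (suc (suc j))) - + (choose a j ℕ.+ choose a (suc j))
      ≡⟨ cong₂ _-_ (ℤ.pos-+ (choose a (suc j)) _) (ℤ.pos-+ (choose a j) _) ⟩
    (+ choose a (suc j) + + choose a (suc (suc j))) - (+ choose a j + + choose a (suc j))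
      ≡⟨ regroup (+ choose a j) (+ choose a (suc j)) (+ choose a (suc (suc j))) ⟩
    choose-diff a (suc j) + choose-diff a j ∎
    where
    open ≡-Reasoning
    regroup : ∀ x y z → (y + z) - (x + y) ≡ (z - y) + (y - x)
    regroup = ℤ-Solver.solve-∀

  -- ballot p j = p / (2j + p) · C(2j + p, j) (see ballot-formula), the coefficient of x^j P^(-2j-p)
  -- in the Lagrange expansion of R^p, where R = (1 + x R²) / P.
  ballot : ℕ → ℕ → ℤ
  ballot p       zero    = 1ℤ
  ballot zero    (suc j) = 0ℤ
  ballot (suc p) (suc j) = choose-diff (suc (suc (j ℕ.+ j ℕ.+ p))) j

  ballot-rec : ∀ p M → ballot (suc p) (suc M) ≡ ballot p (suc M) + ballot (suc (suc p)) M
  ballot-rec zero    zero    = refl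
  ballot-rec (suc p) zero    = begin
    + choose (3 ℕ.+ p) 1 - 1ℤ          ≡⟨ cong (λ c → + c - 1ℤ) (choose-1 (3 ℕ.+ p)) ⟩
    (1ℤ + + (2 ℕ.+ p)) - 1ℤ            ≡⟨ shift (+ (2 ℕ.+ p)) ⟩
    (+ (2 ℕ.+ p) - 1ℤ) + 1ℤ            ≡⟨ cong (λ c → (+ c - 1ℤ) + 1ℤ) (choose-1 (2 ℕ.+ p)) ⟨
    (+ choose (2 ℕ.+ p) 1 - 1ℤ) + 1ℤ   ∎
    where
    open ≡-Reasoning
    shift : ∀ x → (1ℤ + x) - 1ℤ ≡ (x - 1ℤ) + 1ℤ
    shift = ℤ-Solver.solve-∀
  ballot-rec zero    (suc M) = begin
    choose-diff (suc (suc (suc M ℕ.+ suc M ℕ.+ 0))) (suc M)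
      ≡⟨ cong (λ a → choose-diff (suc a) (suc M)) (index₁ M) ⟩
    choose-diff (suc b) (suc M)
      ≡⟨ choose-diff-pascal b M ⟩
    choose-diff b (suc M) + choose-diff b M
      ≡⟨ cong (_+ choose-diff b M) middle≡0 ⟩
    0ℤ + choose-diff b M
      ≡⟨ cong (λ a → 0ℤ + choose-diff a M) (index₂ M) ⟩
    0ℤ + choose-diff (suc (suc (M ℕ.+ M ℕ.+ 1))) M ∎
    where
    open ≡-Reasoning
    b = suc (suc M ℕ.+ suc M)
    index₁ : ∀ M → suc (suc M ℕ.+ suc M ℕ.+ 0) ≡ suc (suc M ℕ.+ suc M)
    index₁ = ℕ-Solver.solve-∀
    index₂ : ∀ M → suc (suc M ℕ.+ suc M) ≡ suc (suc (M ℕ.+ M ℕ.+ 1))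
    index₂ = ℕ-Solver.solve-∀
    middle≡0 : choose-diff b (suc M) ≡ 0ℤ
    middle≡0 = trans (cong (λ c → + c - + choose b (suc M)) (choose-middle (suc M)))
                     (ℤ.+-inverseʳ (+ choose b (suc M)))
  ballot-rec (suc p) (suc M) = begin
    choose-diff (suc (suc (suc M ℕ.+ suc M ℕ.+ suc p))) (suc M)
      ≡⟨ cong (λ a → choose-diff a (suc M)) (index₁ M p) ⟩
    choose-diff (suc b) (suc M)
      ≡⟨ choose-diff-pascal b M ⟩
    choose-diff b (suc M) + choose-diff b M
      ≡⟨ cong (λ a → choose-diff b (suc M) + choose-diff a M) (index₂ M p) ⟩
    choose-diff b (suc M) + choose-diff (suc (suc (M ℕ.+ M ℕ.+ suc (suc p)))) M ∎
    where
    open ≡-Reasoning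
    b = suc (suc (suc M ℕ.+ suc M ℕ.+ p))
    index₁ : ∀ M p → suc (suc (suc M ℕ.+ suc M ℕ.+ suc p)) ≡ suc (suc (suc (suc M ℕ.+ suc M ℕ.+ p)))
    index₁ = ℕ-Solver.solve-∀
    index₂ : ∀ M p → suc (suc (suc M ℕ.+ suc M ℕ.+ p)) ≡ suc (suc (M ℕ.+ M ℕ.+ suc (suc p)))
    index₂ = ℕ-Solver.solve-∀

  ballot-formula : ∀ p j →
    + (j ℕ.+ j ℕ.+ suc p) * ballot (suc p) j ≡ + suc p * + choose (j ℕ.+ j ℕ.+ suc p) j
  ballot-formula p zero    = refl
  ballot-formula p (suc j) = begin
    + N * (+ y - + x)
      ≡⟨ cong (_* (+ y - + x)) N≡J+J+P ⟩
    (+ suc j + + suc j + + suc p) * (+ y - + x)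
      ≡⟨ cancel-absorbed (+ suc j) (+ suc p) (+ x) (+ y) absorbed ⟩
    + suc p * (+ x + + y)
      ≡⟨ cong (+ suc p *_) (ℤ.pos-+ x y) ⟨
    + suc p * + choose (suc a) (suc j)
      ≡⟨ cong (λ n → + suc p * + choose n (suc j)) (N≡ j p) ⟨
    + suc p * + choose N (suc j) ∎
    where
    open ≡-Reasoning
    a = suc (suc (j ℕ.+ j ℕ.+ p))
    N = suc j ℕ.+ suc j ℕ.+ suc p
    x = choose a j
    y = choose a (suc j)
    N≡ : ∀ j p → suc j ℕ.+ suc j ℕ.+ suc p ≡ suc (suc (suc (j ℕ.+ j ℕ.+ p)))
    N≡ = ℕ-Solver.solve-∀
    N≡J+J+P : + N ≡ + suc j + + suc j + + suc p
    N≡J+J+P = trans (ℤ.pos-+ (suc j ℕ.+ suc j) (suc p)) (cong (_+ + suc p) (ℤ.pos-+ (suc j) (suc j)))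
    absorbed : + suc j * (+ x + + y) ≡ (+ suc j + + suc j + + suc p) * + x
    absorbed = begin
      + suc j * (+ x + + y)         ≡⟨ trans (ℤ.pos-* (suc j) (x ℕ.+ y)) (cong (+ suc j *_) (ℤ.pos-+ x y)) ⟨
      + (suc j ℕ.* (x ℕ.+ y))       ≡⟨ cong +_ (choose-absorb a j) ⟩
      + (suc a ℕ.* x)               ≡⟨ cong (λ n → + (n ℕ.* x)) (N≡ j p) ⟨
      + (N ℕ.* x)                   ≡⟨ ℤ.pos-* N x ⟩
      + N * + x                     ≡⟨ cong (_* + x) N≡J+J+P ⟩
      (+ suc j + + suc j + + suc p) * + x ∎
    cancel-absorbed : ∀ J p x y → J * (x + y) ≡ (J + J + p) * x → (J + J + p) * (y - x) ≡ p * (x + y)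
    cancel-absorbed J p x y Jc≡Nx = begin
      (J + J + p) * (y - x)
        ≡⟨ expand J p x y ⟩
      p * (x + y) + + 2 * (J * (x + y) - (J + J + p) * x)
        ≡⟨ cong (λ z → p * (x + y) + + 2 * (z - (J + J + p) * x)) Jc≡Nx ⟩
      p * (x + y) + + 2 * ((J + J + p) * x - (J + J + p) * x)
        ≡⟨ collapse (p * (x + y)) ((J + J + p) * x) ⟩
      p * (x + y) ∎
      where
      expand : ∀ J p x y → (J + J + p) * (y - x) ≡ p * (x + y) + + 2 * (J * (x + y) - (J + J + p) * x)
      expand = ℤ-Solver.solve-∀
      collapse : ∀ a b → a + + 2 * (b - b) ≡ a
      collapse = ℤ-Solver.solve-∀

module InversePowers where

  open FiniteSums
  open PowerSeries
  open Ballot using (choose; choose-diag; choose-<)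
  open import Data.Nat as ℕ using (ℕ; zero; suc; _∸_; _<_; z≤n)
  open import Data.Nat.DivMod using (_/_; _%_; m≡m%n+[m/n]*n; m%n<n; m/n≤m)
  open import Data.Sum using (inj₁; inj₂)
  import Data.Nat.Properties as ℕ
  open import Data.Nat.Induction using (<-rec)
  open import Data.Integer as ℤ using (ℤ; +_; 0ℤ; 1ℤ; _+_; _*_; -_; _-_)
  import Data.Integer.Properties as ℤ
  open import Data.Integer.Tactic.RingSolver as ℤ-Solver using ()
  open import Relation.Binary.PropositionalEquality
  open SeriesSolver using (solve; _:=_; _:+_; _:*_; _:-_) renaming (con to K)

  P : Series
  P = 1ₛ +ₛ xₛ -ₛ xₛ ^ₛ 2

  P*ₛ-expand : ∀ f → P *ₛ f ≐ f +ₛ xₛ *ₛ f -ₛ xₛ *ₛ (xₛ *ₛ f)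
  P*ₛ-expand f = solve 2 (λ x f → (K (+ 1) :+ x :- x :* (x :* K (+ 1))) :* f := f :+ x :* f :- x :* (x :* f))
    ≐-refl xₛ f

  P*ₛ-coeff₀ : ∀ f → (P *ₛ f) 0 ≡ f 0
  P*ₛ-coeff₀ f = trans (P*ₛ-expand f 0) (trans (ℤ.+-identityʳ (f 0 + 0ℤ)) (ℤ.+-identityʳ (f 0)))

  P*ₛ-coeff₁ : ∀ f → (P *ₛ f) 1 ≡ f 1 + f 0
  P*ₛ-coeff₁ f = trans (P*ₛ-expand f 1)
    (trans (cong₂ (λ a b → (f 1 + a) - b) (x*ₛ-shift f 0) (x*ₛ-shift (xₛ *ₛ f) 0)) (ℤ.+-identityʳ _))

  P*ₛ-coeff₂₊ : ∀ f m → (P *ₛ f) (suc (suc m)) ≡ f (suc (suc m)) + f (suc m) - f m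
  P*ₛ-coeff₂₊ f m = trans (P*ₛ-expand f (suc (suc m))) (cong₂ (λ a b → (f (suc (suc m)) + a) - b)
    (x*ₛ-shift f (suc m)) (trans (x*ₛ-shift (xₛ *ₛ f) (suc m)) (x*ₛ-shift f m)))

  sgnℤ : ℕ → ℤ
  sgnℤ zero    = 1ℤ
  sgnℤ (suc m) = - sgnℤ m

  multichoose : ℕ → ℕ → ℕ
  multichoose zero    zero    = 1
  multichoose zero    (suc l) = 0
  multichoose (suc N) zero    = 1
  multichoose (suc N) (suc l) = multichoose N (suc l) ℕ.+ multichoose (suc N) l

  multichoose-suc : ∀ N l → multichoose (suc N) l ≡ choose (N ℕ.+ l) l
  multichoose-suc N       zero    = refl
  multichoose-suc zero    (suc l) =
    trans (multichoose-suc zero l) (trans (choose-diag l) (sym (choose-diag (suc l))))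
  multichoose-suc (suc N) (suc l) =
    trans (cong₂ ℕ._+_ (multichoose-suc N (suc l))
                       (trans (multichoose-suc (suc N) l) (cong (λ a → choose a l) (sym (ℕ.+-suc N l)))))
          (ℕ.+-comm (choose (N ℕ.+ suc l) (suc l)) (choose (N ℕ.+ suc l) l))

  multichoose-0 : ∀ N → multichoose N 0 ≡ 1
  multichoose-0 zero    = refl
  multichoose-0 (suc N) = refl

  -- P⁻¹ = Σ_l (x (x - 1))^l, so [x^m] P^(-N) = (-1)^m Σ_l multichoose N l · C(l, m - l).
  absCoeff : ℕ → ℕ → ℤ
  absCoeff N m = sumℤ≤ m (λ l → + (multichoose N l ℕ.* choose l (m ∸ l)))

  P⁻¹^ : ℕ → Series
  P⁻¹^ N m = sgnℤ m * absCoeff N m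

  absCoeff-head : ∀ N m →
    absCoeff N (suc m) ≡ sumℤ≤ m (λ l → + (multichoose N (suc l) ℕ.* choose (suc l) (m ∸ l)))
  absCoeff-head N m =
    trans (sum-head m _) (trans (cong (λ c → + c + Σ) (ℕ.*-zeroʳ (multichoose N 0))) (ℤ.+-identityˡ Σ))
    where Σ = sumℤ≤ m (λ l → + (multichoose N (suc l) ℕ.* choose (suc l) (m ∸ l)))

  absCoeff-pascal : ∀ N m → sumℤ≤ (suc m) (λ l → + (multichoose N l ℕ.* choose (suc l) (suc m ∸ l))) ≡
    absCoeff N m + absCoeff N (suc m)
  absCoeff-pascal N m = begin
    sumℤ≤ m t + t (suc m)
      ≡⟨ cong₂ _+_ (trans (sum-cong m split) (sum-distrib-+ m u v)) last ⟩
    (absCoeff N m + sumℤ≤ m v) + w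
      ≡⟨ ℤ.+-assoc (absCoeff N m) (sumℤ≤ m v) w ⟩
    absCoeff N m + (sumℤ≤ m v + w)
      ≡⟨ cong (λ Σ → absCoeff N m + (Σ + w)) (sum-cong m (λ l l≤m →
           cong (λ i → + (multichoose N l ℕ.* choose l i)) (sym (ℕ.+-∸-assoc 1 l≤m)))) ⟩
    absCoeff N m + absCoeff N (suc m) ∎
    where
    open ≡-Reasoning
    t u v : ℕ → ℤ
    t l = + (multichoose N l ℕ.* choose (suc l) (suc m ∸ l))
    u l = + (multichoose N l ℕ.* choose l (m ∸ l))
    v l = + (multichoose N l ℕ.* choose l (suc (m ∸ l)))
    split : ∀ l → l ℕ.≤ m → t l ≡ u l + v l
    split l l≤m = trans (cong (λ i → + (multichoose N l ℕ.* choose (suc l) i)) (ℕ.+-∸-assoc 1 l≤m))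
      (trans (cong +_ (ℕ.*-distribˡ-+ (multichoose N l) (choose l (m ∸ l)) (choose l (suc (m ∸ l)))))
             (ℤ.pos-+ (multichoose N l ℕ.* choose l (m ∸ l)) _))
    w = + (multichoose N (suc m) ℕ.* choose (suc m) (suc m ∸ suc m))
    last : t (suc m) ≡ w
    last = trans (cong (λ i → + (multichoose N (suc m) ℕ.* choose (suc (suc m)) i)) (ℕ.n∸n≡0 m))
                 (cong (λ i → + (multichoose N (suc m) ℕ.* choose (suc m) i)) (sym (ℕ.n∸n≡0 m)))

  absCoeff-rec : ∀ N m → absCoeff (suc N) (suc (suc m)) ≡
    absCoeff N (suc (suc m)) + absCoeff (suc N) (suc m) + absCoeff (suc N) m
  absCoeff-rec N m = begin
    absCoeff (suc N) (suc (suc m))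
      ≡⟨ absCoeff-head (suc N) (suc m) ⟩
    sumℤ≤ (suc m) (λ l → + ((multichoose N (suc l) ℕ.+ multichoose (suc N) l) ℕ.* c l))
      ≡⟨ sum-ext (suc m) split ⟩
    sumℤ≤ (suc m) (λ l → shifted l + same l)
      ≡⟨ sum-distrib-+ (suc m) shifted same ⟩
    sumℤ≤ (suc m) shifted + sumℤ≤ (suc m) same
      ≡⟨ cong₂ _+_ (sym (absCoeff-head N (suc m))) (absCoeff-pascal (suc N) m) ⟩
    absCoeff N (suc (suc m)) + (absCoeff (suc N) m + absCoeff (suc N) (suc m))
      ≡⟨ swap (absCoeff N (suc (suc m))) (absCoeff (suc N) m) (absCoeff (suc N) (suc m)) ⟩
    absCoeff N (suc (suc m)) + absCoeff (suc N) (suc m) + absCoeff (suc N) m ∎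
    where
    open ≡-Reasoning
    c : ℕ → ℕ
    c l = choose (suc l) (suc m ∸ l)
    shifted same : ℕ → ℤ
    shifted l = + (multichoose N (suc l) ℕ.* c l)
    same    l = + (multichoose (suc N) l ℕ.* c l)
    split : ∀ l → + ((multichoose N (suc l) ℕ.+ multichoose (suc N) l) ℕ.* c l) ≡ shifted l + same l
    split l = trans (cong +_ (ℕ.*-distribʳ-+ (c l) (multichoose N (suc l)) (multichoose (suc N) l)))
                    (ℤ.pos-+ (multichoose N (suc l) ℕ.* c l) (multichoose (suc N) l ℕ.* c l))
    swap : ∀ a b c → a + (b + c) ≡ a + c + b
    swap = ℤ-Solver.solve-∀

  absCoeff-1 : ∀ N → absCoeff (suc N) 1 ≡ absCoeff N 1 + 1ℤ
  absCoeff-1 N = begin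
    + ((a ℕ.+ 1) ℕ.* 1)   ≡⟨ cong +_ (ℕ.*-identityʳ (a ℕ.+ 1)) ⟩
    + (a ℕ.+ 1)            ≡⟨ ℤ.pos-+ a 1 ⟩
    + a + 1ℤ
      ≡⟨ cong₂ (λ c d → + c + + d + 1ℤ) (ℕ.*-zeroʳ (multichoose N 0)) (ℕ.*-identityʳ a) ⟨
    absCoeff N 1 + 1ℤ      ∎
    where
    open ≡-Reasoning
    a = multichoose N 1

  P*P⁻¹^suc : ∀ N → P *ₛ P⁻¹^ (suc N) ≐ P⁻¹^ N
  P*P⁻¹^suc N zero =
    trans (P*ₛ-coeff₀ (P⁻¹^ (suc N))) (cong (λ c → 1ℤ * + (c ℕ.* 1)) (sym (multichoose-0 N)))
  P*P⁻¹^suc N (suc zero) = begin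
    (P *ₛ P⁻¹^ (suc N)) 1                  ≡⟨ P*ₛ-coeff₁ (P⁻¹^ (suc N)) ⟩
    - 1ℤ * absCoeff (suc N) 1 + 1ℤ * 1ℤ    ≡⟨ cong (λ a → - 1ℤ * a + 1ℤ * 1ℤ) (absCoeff-1 N) ⟩
    - 1ℤ * (absCoeff N 1 + 1ℤ) + 1ℤ * 1ℤ   ≡⟨ cancel (absCoeff N 1) ⟩
    - 1ℤ * absCoeff N 1                    ∎
    where
    open ≡-Reasoning
    cancel : ∀ a → - 1ℤ * (a + 1ℤ) + 1ℤ * 1ℤ ≡ - 1ℤ * a
    cancel = ℤ-Solver.solve-∀
  P*P⁻¹^suc N (suc (suc m)) = begin
    (P *ₛ P⁻¹^ (suc N)) (suc (suc m))
      ≡⟨ P*ₛ-coeff₂₊ (P⁻¹^ (suc N)) m ⟩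
    - - s * absCoeff (suc N) (suc (suc m)) + - s * absCoeff (suc N) (suc m) - s * absCoeff (suc N) m
      ≡⟨ cong (λ a → - - s * a + - s * absCoeff (suc N) (suc m) - s * absCoeff (suc N) m) (absCoeff-rec N m) ⟩
    - - s * (absCoeff N (suc (suc m)) + absCoeff (suc N) (suc m) + absCoeff (suc N) m)
      + - s * absCoeff (suc N) (suc m) - s * absCoeff (suc N) m
      ≡⟨ cancel s (absCoeff N (suc (suc m))) (absCoeff (suc N) (suc m)) (absCoeff (suc N) m) ⟩
    - - s * absCoeff N (suc (suc m)) ∎
    where
    open ≡-Reasoning
    s = sgnℤ m
    cancel : ∀ s a b c → - - s * (a + b + c) + - s * b - s * c ≡ - - s * a
    cancel = ℤ-Solver.solve-∀

  P⁻¹^0 : P⁻¹^ 0 ≐ 1ₛ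
  P⁻¹^0 zero    = refl
  P⁻¹^0 (suc m) = trans (cong (sgnℤ (suc m) *_) (trans (sum-head m _) (trans (ℤ.+-identityˡ _)
    (sum-zero m (λ l _ → refl))))) (ℤ.*-zeroʳ (sgnℤ (suc m)))

  P-recurrence-zero : ∀ (A : ℕ → Series) →
    (∀ p → P *ₛ A (suc p) ≐ A p +ₛ xₛ *ₛ A (suc (suc p))) → A 0 ≐ 0ₛ → ∀ p → A p ≐ 0ₛ
  P-recurrence-zero A A-rec A₀≐0 p m = <-rec (λ m → ∀ p → A p m ≡ 0ℤ) step m p
    where
    x*ₛ-vanishes : ∀ {f} m → OrderAtLeast m f → (xₛ *ₛ f) m ≡ 0ℤ
    x*ₛ-vanishes m ord-f = order-*ₛ 1 m order-x ord-f m ℕ.≤-refl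
    step : ∀ m → (∀ {m′} → m′ < m → ∀ p → A p m′ ≡ 0ℤ) → ∀ p → A p m ≡ 0ℤ
    step m ih zero    = A₀≐0 m
    step m ih (suc p) = begin
      A (suc p) m                                 ≡⟨ isolate (A (suc p) m) (xA m) (xxA m) ⟩
      (A (suc p) m + xA m - xxA m) - xA m + xxA m ≡⟨ cong₂ _+_ (cong₂ _-_ PA≡0 xA≡0) xxA≡0 ⟩
      0ℤ - 0ℤ + 0ℤ                                ≡⟨⟩
      0ℤ                                          ∎
      where
      open ≡-Reasoning
      xA xxA : Series
      xA  = xₛ *ₛ A (suc p)
      xxA = xₛ *ₛ xA
      ord-A : OrderAtLeast m (A (suc p))
      ord-A j j<m = ih j<m (suc p)
      isolate : ∀ a b c → a ≡ (a + b - c) - b + c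
      isolate = ℤ-Solver.solve-∀
      PA≡0 : A (suc p) m + xA m - xxA m ≡ 0ℤ
      PA≡0 = trans (sym (P*ₛ-expand (A (suc p)) m)) (trans (A-rec p m)
               (cong₂ _+_ (step m ih p) (x*ₛ-vanishes m (λ j j<m → ih j<m (suc (suc p))))))
      xA≡0 : xA m ≡ 0ℤ
      xA≡0 = x*ₛ-vanishes m ord-A
      xxA≡0 : xxA m ≡ 0ℤ
      xxA≡0 = x*ₛ-vanishes m (order-weaken (ℕ.n≤1+n m) (order-*ₛ 1 m order-x ord-A))

  ∸<⇐/2< : ∀ M b → M / 2 < b → M ∸ b < b
  ∸<⇐/2< M b M/2<b with ℕ.≤-total b M
  ... | inj₂ M≤b = subst (_< b) (sym (ℕ.m≤n⇒m∸n≡0 M≤b)) (ℕ.≤-<-trans z≤n M/2<b)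
  ... | inj₁ b≤M = ℕ.+-cancelʳ-< b (M ∸ b) b (subst (_< b ℕ.+ b) (sym (ℕ.m∸n+n≡m b≤M)) M<b+b)
    where
    open ℕ.≤-Reasoning
    M<b+b : M < b ℕ.+ b
    M<b+b = begin-strict
      M                        ≡⟨ m≡m%n+[m/n]*n M 2 ⟩
      M % 2 ℕ.+ M / 2 ℕ.* 2    ≤⟨ ℕ.+-monoˡ-≤ (M / 2 ℕ.* 2) (ℕ.≤-pred (m%n<n M 2)) ⟩
      1 ℕ.+ M / 2 ℕ.* 2        <⟨ ℕ.n<1+n _ ⟩
      suc (M / 2) ℕ.* 2        ≤⟨ ℕ.*-monoˡ-≤ 2 M/2<b ⟩
      b ℕ.* 2                  ≡⟨ ℕ.*-comm b 2 ⟩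
      b ℕ.+ (b ℕ.+ 0)          ≡⟨ cong (b ℕ.+_) (ℕ.+-identityʳ b) ⟩
      b ℕ.+ b                  ∎

  -- Substituting l = M - b; the terms with b > M / 2 vanish since then M - b < b.
  absCoeff-halved : ∀ N M → absCoeff (suc N) M ≡
    sumℤ≤ (M / 2) (λ b → + (choose (N ℕ.+ (M ∸ b)) (M ∸ b) ℕ.* choose (M ∸ b) b))
  absCoeff-halved N M = begin
    absCoeff (suc N) M
      ≡⟨ sum-ext M (λ l → cong (λ c → + (c ℕ.* choose l (M ∸ l))) (multichoose-suc N l)) ⟩
    sumℤ≤ M (λ l → + (choose (N ℕ.+ l) l ℕ.* choose l (M ∸ l)))
      ≡⟨ sum-reverse M _ ⟩
    sumℤ≤ M (λ b → + (choose (N ℕ.+ (M ∸ b)) (M ∸ b) ℕ.* choose (M ∸ b) (M ∸ (M ∸ b))))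
      ≡⟨ sum-cong M (λ b b≤M → cong (λ i → term b i) (ℕ.m∸[m∸n]≡n b≤M)) ⟩
    sumℤ≤ M (λ b → term b b)
      ≡⟨ cong (λ L → sumℤ≤ L (λ b → term b b)) (ℕ.m+[n∸m]≡n (m/n≤m M 2)) ⟨
    sumℤ≤ (M / 2 ℕ.+ (M ∸ M / 2)) (λ b → term b b)
      ≡⟨ sum-truncate (M / 2) (M ∸ M / 2) (λ b → term b b) (λ b M/2<b →
           trans (cong (λ c → + (choose (N ℕ.+ (M ∸ b)) (M ∸ b) ℕ.* c))
                       (choose-< (M ∸ b) b (∸<⇐/2< M b M/2<b)))
                 (cong +_ (ℕ.*-zeroʳ (choose (N ℕ.+ (M ∸ b)) (M ∸ b))))) ⟩
    sumℤ≤ (M / 2) (λ b → term b b) ∎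
    where
    open ≡-Reasoning
    term : ℕ → ℕ → ℤ
    term b i = + (choose (N ℕ.+ (M ∸ b)) (M ∸ b) ℕ.* choose (M ∸ b) i)

module LagrangePowers where

  open PowerSeries
  open FiniteSums
  open InversePowers
  open Ballot using (ballot; ballot-rec)
  open import Data.Nat as ℕ using (ℕ; zero; suc; _∸_; _<_; s≤s)
  import Data.Nat.Properties as ℕ
  import Data.Nat.Tactic.RingSolver as ℕ-Solver
  open import Data.Integer as ℤ using (ℤ; 1ℤ; _+_; _*_; -_)
  import Data.Integer.Properties as ℤ
  open import Relation.Binary.PropositionalEquality
  open import Relation.Nullary using (yes; no)
  open SeriesSolver using (solve; _:=_; _:+_; _:*_; _:-_) renaming (con to K)

  ballotTerm : ℕ → ℕ → Series
  ballotTerm p j = constₛ (ballot p j) *ₛ (xₛ ^ₛ j *ₛ P⁻¹^ (j ℕ.+ j ℕ.+ p))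

  partialSum : ℕ → ℕ → Series
  partialSum p zero    = 0ₛ
  partialSum p (suc M) = partialSum p M +ₛ ballotTerm p M

  overflow : ℕ → ℕ → Series
  overflow p zero    = 0ₛ
  overflow p (suc M) = xₛ *ₛ ballotTerm (suc (suc p)) M

  P*ballotTerm : ∀ p M → P *ₛ ballotTerm (suc p) M ≐ ballotTerm p M +ₛ overflow p M
  P*ballotTerm p M = begin
    P *ₛ ballotTerm (suc p) M
      ≈⟨ solve 4 (λ P b x q → P :* (b :* (x :* q)) := b :* (x :* (P :* q)))
           ≐-refl P (constₛ (ballot (suc p) M)) (xₛ ^ₛ M) (P⁻¹^ (M ℕ.+ M ℕ.+ suc p)) ⟩
    constₛ (ballot (suc p) M) *ₛ (xₛ ^ₛ M *ₛ (P *ₛ P⁻¹^ (M ℕ.+ M ℕ.+ suc p)))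
      ≈⟨ *ₛ-cong (≐-refl {constₛ (ballot (suc p) M)}) (*ₛ-cong (≐-refl {xₛ ^ₛ M}) P-cancels) ⟩
    constₛ (ballot (suc p) M) *ₛ (xₛ ^ₛ M *ₛ P⁻¹^ (M ℕ.+ M ℕ.+ p))
      ≈⟨ by-ballot-rec M ⟩
    ballotTerm p M +ₛ overflow p M ∎
    where
    open SeriesReasoning
    P-cancels : P *ₛ P⁻¹^ (M ℕ.+ M ℕ.+ suc p) ≐ P⁻¹^ (M ℕ.+ M ℕ.+ p)
    P-cancels = ≐-trans (λ n → cong (λ N → (P *ₛ P⁻¹^ N) n) (ℕ.+-suc (M ℕ.+ M) p))
                        (P*P⁻¹^suc (M ℕ.+ M ℕ.+ p))
    by-ballot-rec : ∀ M → constₛ (ballot (suc p) M) *ₛ (xₛ ^ₛ M *ₛ P⁻¹^ (M ℕ.+ M ℕ.+ p)) ≐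
                          ballotTerm p M +ₛ overflow p M
    by-ballot-rec zero     n = sym (ℤ.+-identityʳ _)
    by-ballot-rec (suc M′) = begin
      constₛ (ballot (suc p) (suc M′)) *ₛ Y
        ≈⟨ *ₛ-cong (≐-trans (λ n → cong (λ b → constₛ b n) (ballot-rec p M′)) (constₛ-+ b₀ b₂))
                   (≐-refl {Y}) ⟩
      (constₛ b₀ +ₛ constₛ b₂) *ₛ Y
        ≈⟨ *ₛ-distribʳ Y (constₛ b₀) (constₛ b₂) ⟩
      ballotTerm p (suc M′) +ₛ constₛ b₂ *ₛ Y
        ≈⟨ +ₛ-cong (≐-refl {ballotTerm p (suc M′)}) (*ₛ-cong (≐-refl {constₛ b₂})
             (*ₛ-cong (≐-refl {xₛ ^ₛ suc M′}) (λ n → cong (λ N → P⁻¹^ N n) (index M′ p)))) ⟩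
      ballotTerm p (suc M′)
        +ₛ constₛ b₂ *ₛ (xₛ ^ₛ suc M′ *ₛ P⁻¹^ (M′ ℕ.+ M′ ℕ.+ suc (suc p)))
        ≈⟨ +ₛ-cong (≐-refl {ballotTerm p (suc M′)})
             (solve 4 (λ b x y q → b :* ((x :* y) :* q) := x :* (b :* (y :* q)))
               ≐-refl (constₛ b₂) xₛ (xₛ ^ₛ M′) (P⁻¹^ (M′ ℕ.+ M′ ℕ.+ suc (suc p)))) ⟩
      ballotTerm p (suc M′) +ₛ overflow p (suc M′) ∎
      where
      b₀ = ballot p (suc M′)
      b₂ = ballot (suc (suc p)) M′
      Y = xₛ ^ₛ suc M′ *ₛ P⁻¹^ (suc M′ ℕ.+ suc M′ ℕ.+ p)
      index : ∀ M p → suc M ℕ.+ suc M ℕ.+ p ≡ M ℕ.+ M ℕ.+ suc (suc p)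
      index = ℕ-Solver.solve-∀

  P*partialSum : ∀ p M →
    P *ₛ partialSum (suc p) M +ₛ overflow p M ≐ partialSum p M +ₛ xₛ *ₛ partialSum (suc (suc p)) M
  P*partialSum p zero    =
    ≐-trans (+ₛ-cong (*ₛ-zeroʳ P) (≐-refl {0ₛ})) (≐-sym (+ₛ-cong (≐-refl {0ₛ}) (*ₛ-zeroʳ xₛ)))
  P*partialSum p (suc M) = begin
    P *ₛ (partialSum (suc p) M +ₛ ballotTerm (suc p) M) +ₛ overflow p (suc M)
      ≈⟨ +ₛ-cong (≐-trans (*ₛ-distribˡ P (partialSum (suc p) M) (ballotTerm (suc p) M))
                          (+ₛ-cong (≐-refl {P *ₛ partialSum (suc p) M}) (P*ballotTerm p M))) ≐-refl ⟩
    P *ₛ partialSum (suc p) M +ₛ (ballotTerm p M +ₛ overflow p M) +ₛ overflow p (suc M)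
      ≈⟨ solve 4 (λ a e t e′ → (a :+ (t :+ e)) :+ e′ := (a :+ e) :+ t :+ e′)
           ≐-refl (P *ₛ partialSum (suc p) M) (overflow p M) (ballotTerm p M) (overflow p (suc M)) ⟩
    (P *ₛ partialSum (suc p) M +ₛ overflow p M) +ₛ ballotTerm p M +ₛ overflow p (suc M)
      ≈⟨ +ₛ-cong (+ₛ-cong (P*partialSum p M) ≐-refl) ≐-refl ⟩
    (partialSum p M +ₛ xₛ *ₛ partialSum (suc (suc p)) M) +ₛ ballotTerm p M
      +ₛ xₛ *ₛ ballotTerm (suc (suc p)) M
      ≈⟨ solve 5 (λ f x g t t′ → (f :+ x :* g) :+ t :+ x :* t′ := (f :+ t) :+ x :* (g :+ t′)) ≐-refl
           (partialSum p M) xₛ (partialSum (suc (suc p)) M) (ballotTerm p M) (ballotTerm (suc (suc p)) M) ⟩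
    partialSum p (suc M) +ₛ xₛ *ₛ partialSum (suc (suc p)) (suc M) ∎
    where open SeriesReasoning

  order-ballotTerm : ∀ p j → OrderAtLeast j (ballotTerm p j)
  order-ballotTerm p j =
    order-*ₛ 0 j (order-0 (constₛ (ballot p j))) (order-*ₛˡ (P⁻¹^ (j ℕ.+ j ℕ.+ p)) (order-^ₛ j order-x))

  order-overflow : ∀ p M → OrderAtLeast M (overflow p M)
  order-overflow p zero    = order-0 _
  order-overflow p (suc M) = order-*ₛ 1 M order-x (order-ballotTerm (suc (suc p)) M)

  -- Coefficient m of the infinite sum Σ_j ballotTerm p j only involves the terms j ≤ m.
  expansion : ℕ → Series
  expansion p m = partialSum p (suc m) m

  partialSum-stable : ∀ p M m → m < M → partialSum p M m ≡ expansion p m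
  partialSum-stable p (suc M) m m<1+M with m ℕ.≟ M
  ... | yes refl = refl
  ... | no  m≢M  = trans (cong (λ z → partialSum p M m + z) (order-ballotTerm p M m m<M))
                         (trans (ℤ.+-identityʳ _) (partialSum-stable p M m m<M))
    where
    m<M : m < M
    m<M = ℕ.≤∧≢⇒< (ℕ.≤-pred m<1+M) m≢M

  *ₛ-expansion : ∀ f p m → (f *ₛ expansion p) m ≡ (f *ₛ partialSum p (suc m)) m
  *ₛ-expansion f p m = sum-cong m (λ i i≤m →
    cong (f i *_) (sym (partialSum-stable p (suc m) (m ∸ i) (s≤s (ℕ.m∸n≤m m i)))))

  expansion-rec : ∀ p → P *ₛ expansion (suc p) ≐ expansion p +ₛ xₛ *ₛ expansion (suc (suc p))
  expansion-rec p m = begin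
    (P *ₛ expansion (suc p)) m
      ≡⟨ *ₛ-expansion P (suc p) m ⟩
    (P *ₛ partialSum (suc p) (suc m)) m
      ≡⟨ trans (cong (λ z → (P *ₛ partialSum (suc p) (suc m)) m + z) (order-overflow p (suc m) m ℕ.≤-refl))
               (ℤ.+-identityʳ _) ⟨
    (P *ₛ partialSum (suc p) (suc m)) m + overflow p (suc m) m
      ≡⟨ P*partialSum p (suc m) m ⟩
    partialSum p (suc m) m + (xₛ *ₛ partialSum (suc (suc p)) (suc m)) m
      ≡⟨ cong (λ z → expansion p m + z) (*ₛ-expansion xₛ (suc (suc p)) m) ⟨
    expansion p m + (xₛ *ₛ expansion (suc (suc p))) m ∎
    where open ≡-Reasoning

  expansion-0 : expansion 0 ≐ 1ₛ
  expansion-0 m = begin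
    partialSum 0 (suc m) m         ≡⟨ only-first m m ⟩
    ballotTerm 0 0 m               ≡⟨ *ₛ-identityˡ (1ₛ *ₛ P⁻¹^ 0) m ⟩
    (1ₛ *ₛ P⁻¹^ 0) m               ≡⟨ *ₛ-identityˡ (P⁻¹^ 0) m ⟩
    P⁻¹^ 0 m                       ≡⟨ P⁻¹^0 m ⟩
    1ₛ m                           ∎
    where
    open ≡-Reasoning
    only-first : ∀ M → partialSum 0 (suc M) ≐ ballotTerm 0 0
    only-first zero    n = ℤ.+-identityˡ _
    only-first (suc M) n = trans (cong₂ _+_ (only-first M n)
        (zeroˡ⇒*ₛ≐0 (xₛ ^ₛ suc M *ₛ P⁻¹^ (suc M ℕ.+ suc M ℕ.+ 0)) constₛ-0 n))
      (ℤ.+-identityʳ _)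

  R^-rec : ∀ R → P *ₛ R ≐ 1ₛ +ₛ xₛ *ₛ (R *ₛ R) →
    ∀ p → P *ₛ R ^ₛ suc p ≐ R ^ₛ p +ₛ xₛ *ₛ R ^ₛ suc (suc p)
  R^-rec R P*R≐1+xR² p =
    -ₛ≐0⇒≐ (≐-trans identity (zeroˡ⇒*ₛ≐0 (R ^ₛ p) (≐⇒-ₛ≐0 P*R≐1+xR²)))
    where
    identity : P *ₛ R ^ₛ suc p -ₛ (R ^ₛ p +ₛ xₛ *ₛ R ^ₛ suc (suc p)) ≐
               (P *ₛ R -ₛ (1ₛ +ₛ xₛ *ₛ (R *ₛ R))) *ₛ R ^ₛ p
    identity = solve 3 (λ x r w → let p = K 1ℤ :+ x :- x :* (x :* K 1ℤ) in
      p :* (r :* w) :- (w :+ x :* (r :* (r :* w))) := (p :* r :- (K 1ℤ :+ x :* (r :* r))) :* w)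
      ≐-refl xₛ R (R ^ₛ p)

  R^≐expansion : ∀ R → P *ₛ R ≐ 1ₛ +ₛ xₛ *ₛ (R *ₛ R) → ∀ p → R ^ₛ p ≐ expansion p
  R^≐expansion R P*R≐1+xR² p = ≐-sym (-ₛ≐0⇒≐
    (P-recurrence-zero (λ p → expansion p -ₛ R ^ₛ p) difference-rec
      (λ m → trans (cong (_+ - 1ₛ m) (expansion-0 m)) (ℤ.+-inverseʳ (1ₛ m))) p))
    where
    difference-rec : ∀ p → P *ₛ (expansion (suc p) -ₛ R ^ₛ suc p) ≐
      (expansion p -ₛ R ^ₛ p) +ₛ xₛ *ₛ (expansion (suc (suc p)) -ₛ R ^ₛ suc (suc p))
    difference-rec p = begin
      P *ₛ (expansion (suc p) -ₛ R ^ₛ suc p)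
        ≈⟨ solve 3 (λ P f r → P :* (f :- r) := P :* f :- P :* r)
             ≐-refl P (expansion (suc p)) (R ^ₛ suc p) ⟩
      P *ₛ expansion (suc p) -ₛ P *ₛ R ^ₛ suc p
        ≈⟨ +ₛ-cong (expansion-rec p) (-ₛ-cong (R^-rec R P*R≐1+xR² p)) ⟩
      (expansion p +ₛ xₛ *ₛ expansion (suc (suc p))) -ₛ (R ^ₛ p +ₛ xₛ *ₛ R ^ₛ suc (suc p))
        ≈⟨ solve 5 (λ x f₀ f₂ r₀ r₂ →
               (f₀ :+ x :* f₂) :- (r₀ :+ x :* r₂) := (f₀ :- r₀) :+ x :* (f₂ :- r₂))
             ≐-refl xₛ (expansion p) (expansion (suc (suc p))) (R ^ₛ p) (R ^ₛ suc (suc p)) ⟩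
      (expansion p -ₛ R ^ₛ p) +ₛ xₛ *ₛ (expansion (suc (suc p)) -ₛ R ^ₛ suc (suc p)) ∎
      where open SeriesReasoning

  R^-coeff : ∀ R → P *ₛ R ≐ 1ₛ +ₛ xₛ *ₛ (R *ₛ R) →
    ∀ p m → (R ^ₛ p) m ≡ sumℤ≤ m (λ j → ballot p j * P⁻¹^ (j ℕ.+ j ℕ.+ p) (m ∸ j))
  R^-coeff R P*R≐1+xR² p m =
    trans (R^≐expansion R P*R≐1+xR² p m) (trans (partialSum-sum m m) (sum-cong m ballotTerm-coeff))
    where
    partialSum-sum : ∀ M n → partialSum p (suc M) n ≡ sumℤ≤ M (λ j → ballotTerm p j n)
    partialSum-sum zero    n = ℤ.+-identityˡ _
    partialSum-sum (suc M) n = cong (_+ ballotTerm p (suc M) n) (partialSum-sum M n)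
    ballotTerm-coeff : ∀ j → j ℕ.≤ m → ballotTerm p j m ≡ ballot p j * P⁻¹^ (j ℕ.+ j ℕ.+ p) (m ∸ j)
    ballotTerm-coeff j j≤m = trans (constₛ-scale (ballot p j) (xₛ ^ₛ j *ₛ P⁻¹^ (j ℕ.+ j ℕ.+ p)) m)
      (cong (ballot p j *_) (trans (cong (xₛ ^ₛ j *ₛ P⁻¹^ (j ℕ.+ j ℕ.+ p)) (sym (ℕ.m+[n∸m]≡n j≤m)))
                                   (x^ₛ*ₛ-shift j (P⁻¹^ (j ℕ.+ j ℕ.+ p)) (m ∸ j))))

module Rationals where

  open import Data.Nat as ℕ using (ℕ; zero; suc)
  import Data.Nat.Properties as ℕ
  open import Data.Integer as ℤ using (ℤ; +_; 1ℤ)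
  import Data.Integer.Properties as ℤ
  open import Data.Integer.Tactic.RingSolver using (solve-∀)
  open import Data.Rational as ℚ using (ℚ; fromℚᵘ)
  import Data.Rational.Properties as ℚ
  open import Data.Rational.Unnormalised as ℚᵘ using (ℚᵘ; mkℚᵘ; *≡*)
  import Data.Rational.Unnormalised.Properties as ℚᵘ
  open import Relation.Binary.PropositionalEquality

  toℚ : ℤ → ℚ
  toℚ z = z ℚ./ 1

  fromℚᵘ-+ : ∀ p q → fromℚᵘ (p ℚᵘ.+ q) ≡ fromℚᵘ p ℚ.+ fromℚᵘ q
  fromℚᵘ-+ p q = trans (ℚ.fromℚᵘ-cong (ℚᵘ.≃-sym (ℚᵘ.≃-trans
      (ℚ.toℚᵘ-homo-+ (fromℚᵘ p) (fromℚᵘ q))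
      (ℚᵘ.+-cong (ℚ.toℚᵘ-fromℚᵘ p) (ℚ.toℚᵘ-fromℚᵘ q)))))
    (ℚ.fromℚᵘ-toℚᵘ _)

  fromℚᵘ-* : ∀ p q → fromℚᵘ (p ℚᵘ.* q) ≡ fromℚᵘ p ℚ.* fromℚᵘ q
  fromℚᵘ-* p q = trans (ℚ.fromℚᵘ-cong (ℚᵘ.≃-sym (ℚᵘ.≃-trans
      (ℚ.toℚᵘ-homo-* (fromℚᵘ p) (fromℚᵘ q))
      (ℚᵘ.*-cong (ℚ.toℚᵘ-fromℚᵘ p) (ℚ.toℚᵘ-fromℚᵘ q)))))
    (ℚ.fromℚᵘ-toℚᵘ _)

  fromℚᵘ-neg : ∀ p → fromℚᵘ (ℚᵘ.- p) ≡ ℚ.- fromℚᵘ p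
  fromℚᵘ-neg p = trans (ℚ.fromℚᵘ-cong (ℚᵘ.≃-sym (ℚᵘ.≃-trans
      (ℚ.toℚᵘ-homo‿- (fromℚᵘ p)) (ℚᵘ.-‿cong (ℚ.toℚᵘ-fromℚᵘ p)))))
    (ℚ.fromℚᵘ-toℚᵘ _)

  toℚ-+ : ∀ a b → toℚ (a ℤ.+ b) ≡ toℚ a ℚ.+ toℚ b
  toℚ-+ a b =
    trans (ℚ.fromℚᵘ-cong {mkℚᵘ (a ℤ.+ b) 0} {mkℚᵘ a 0 ℚᵘ.+ mkℚᵘ b 0} (*≡* (lemma a b)))
          (fromℚᵘ-+ (mkℚᵘ a 0) (mkℚᵘ b 0))
    where
    lemma : ∀ a b → (a ℤ.+ b) ℤ.* 1ℤ ≡ (a ℤ.* 1ℤ ℤ.+ b ℤ.* 1ℤ) ℤ.* 1ℤ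
    lemma = solve-∀

  toℚ-* : ∀ a b → toℚ (a ℤ.* b) ≡ toℚ a ℚ.* toℚ b
  toℚ-* a b = fromℚᵘ-* (mkℚᵘ a 0) (mkℚᵘ b 0)

  toℚ-neg : ∀ a → toℚ (ℤ.- a) ≡ ℚ.- toℚ a
  toℚ-neg a = fromℚᵘ-neg (mkℚᵘ a 0)

  toℚ-sum : ∀ m f → toℚ (sumℤ≤ m f) ≡ sumℚ< (suc m) (λ i → toℚ (f i))
  toℚ-sum zero    f = sym (ℚ.+-identityˡ (toℚ (f 0)))
  toℚ-sum (suc m) f = trans (toℚ-+ (sumℤ≤ m f) (f (suc m))) (cong (ℚ._+ toℚ (f (suc m))) (toℚ-sum m f))

  sumℚ<-cong : ∀ L {f g : ℕ → ℚ} → (∀ i → i ℕ.< L → f i ≡ g i) → sumℚ< L f ≡ sumℚ< L g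
  sumℚ<-cong zero    f≡g = refl
  sumℚ<-cong (suc L) f≡g =
    cong₂ ℚ._+_ (sumℚ<-cong L (λ i i<L → f≡g i (ℕ.m<n⇒m<1+n i<L))) (f≡g L ℕ.≤-refl)

  frac*natℚ : ∀ a b c B → + a ℤ.* + c ≡ B ℤ.* + suc b → frac a (suc b) ℚ.* natℚ c ≡ toℚ B
  frac*natℚ a b c B ac≡B[1+b] =
    trans (sym (fromℚᵘ-* (mkℚᵘ (+ a) b) (mkℚᵘ (+ c) 0)))
          (ℚ.fromℚᵘ-cong {mkℚᵘ (+ a) b ℚᵘ.* mkℚᵘ (+ c) 0} {mkℚᵘ B 0} (*≡* cross))
    where
    cross : (+ a ℤ.* + c) ℤ.* 1ℤ ≡ B ℤ.* + suc (b ℕ.* 1)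
    cross = trans (ℤ.*-identityʳ _) (trans ac≡B[1+b] (cong (λ d → B ℤ.* + suc d) (sym (ℕ.*-identityʳ b))))

module ExplicitFormula where

  open InversePowers using (P⁻¹^; sgnℤ; absCoeff; absCoeff-halved)
  open Ballot using (choose; choose≡C; ballot; ballot-formula)
  open Rationals
  open import Data.Nat as ℕ using (ℕ; zero; suc; _∸_; _≤_)
  import Data.Nat.Properties as ℕ
  open import Data.Nat.DivMod using (_/_; m/n≤m)
  open import Data.Nat.Combinatorics using (_C_)
  import Data.Nat.Tactic.RingSolver as ℕ-Solver
  open import Data.Rational as ℚ using (ℚ)
  import Data.Rational.Properties as ℚ
  open import Data.Integer using (+_; _*_)
  import Data.Integer.Properties as ℤ
  open import Relation.Binary.PropositionalEquality

  sign≡toℚ-sgnℤ : ∀ M → sign M ≡ toℚ (sgnℤ M)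
  sign≡toℚ-sgnℤ zero    = refl
  sign≡toℚ-sgnℤ (suc M) = trans (cong ℚ.-_ (sign≡toℚ-sgnℤ M)) (sym (toℚ-neg (sgnℤ M)))

  formulaTerm : ℕ → ℕ → ℕ → ℚ
  formulaTerm n k j =
    frac (k ∸ 1) (2 ℕ.* j ℕ.+ k ∸ 1) ℚ.* natℚ ((2 ℕ.* j ℕ.+ k ∸ 1) C j)
    ℚ.* sign (n ∸ k ∸ 1 ∸ j)
    ℚ.* sumℚ< (suc ((n ∸ k ∸ 1 ∸ j) / 2)) (λ b →
          natℚ (((n ℕ.+ j ∸ b ∸ 3) C (n ∸ k ∸ 1 ∸ j ∸ b)) ℕ.* ((n ∸ k ∸ 1 ∸ j ∸ b) C b)))

  ballot-as-fraction : ∀ p j →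
    frac (suc p) (suc (j ℕ.+ j ℕ.+ p)) ℚ.* natℚ (suc (j ℕ.+ j ℕ.+ p) C j) ≡ toℚ (ballot (suc p) j)
  ballot-as-fraction p j = frac*natℚ (suc p) N (suc N C j) (ballot (suc p) j) (begin
    + suc p * + (suc N C j)
      ≡⟨ cong (λ c → + suc p * + c) (choose≡C (suc N) j) ⟨
    + suc p * + choose (suc N) j
      ≡⟨ cong (λ a → + suc p * + choose a j) (ℕ.+-suc (j ℕ.+ j) p) ⟨
    + suc p * + choose (j ℕ.+ j ℕ.+ suc p) j
      ≡⟨ ballot-formula p j ⟨
    + (j ℕ.+ j ℕ.+ suc p) * ballot (suc p) j
      ≡⟨ cong (λ a → + a * ballot (suc p) j) (ℕ.+-suc (j ℕ.+ j) p) ⟩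
    + suc N * ballot (suc p) j
      ≡⟨ ℤ.*-comm (+ suc N) (ballot (suc p) j) ⟩
    ballot (suc p) j * + suc N ∎)
    where
    open ≡-Reasoning
    N = j ℕ.+ j ℕ.+ p

  absCoeff-as-sum : ∀ N M (top : ℕ → ℕ) → (∀ b → b ≤ M → top b ≡ N ℕ.+ (M ∸ b)) →
    sumℚ< (suc (M / 2)) (λ b → natℚ ((top b C (M ∸ b)) ℕ.* ((M ∸ b) C b))) ≡ toℚ (absCoeff (suc N) M)
  absCoeff-as-sum N M top top≡ = sym (trans (cong toℚ (absCoeff-halved N M)) (trans (toℚ-sum (M / 2) _)
    (sumℚ<-cong (suc (M / 2)) (λ b b<1+M/2 → cong natℚ (cong₂ ℕ._*_
      (trans (choose≡C (N ℕ.+ (M ∸ b)) (M ∸ b))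
             (cong (_C (M ∸ b)) (sym (top≡ b (ℕ.≤-trans (ℕ.≤-pred b<1+M/2) (m/n≤m M 2))))))
      (choose≡C (M ∸ b) b))))))

  formulaTerm≡ : ∀ p m j → j ≤ m →
    formulaTerm (suc (suc (suc p)) ℕ.+ m) (suc (suc p)) j ≡
    toℚ (ballot (suc p) j * P⁻¹^ (j ℕ.+ j ℕ.+ suc p) (m ∸ j))
  formulaTerm≡ p m j j≤m = begin
    formulaTerm n (suc (suc p)) j
      ≡⟨ cong₂ (λ A M′ → frac (suc p) A ℚ.* natℚ (A C j) ℚ.* sign M′
                           ℚ.* sumℚ< (suc (M′ / 2)) (inner M′))
               (2j+k∸1≡ j p) n∸k∸1∸j≡ ⟩
    frac (suc p) (suc N) ℚ.* natℚ (suc N C j) ℚ.* sign M ℚ.* sumℚ< (suc (M / 2)) (inner M)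
      ≡⟨ cong₂ ℚ._*_ (cong₂ ℚ._*_ (ballot-as-fraction p j) (sign≡toℚ-sgnℤ M))
                     (absCoeff-as-sum N M _ index) ⟩
    toℚ (ballot (suc p) j) ℚ.* toℚ (sgnℤ M) ℚ.* toℚ (absCoeff (suc N) M)
      ≡⟨ ℚ.*-assoc (toℚ (ballot (suc p) j)) _ _ ⟩
    toℚ (ballot (suc p) j) ℚ.* (toℚ (sgnℤ M) ℚ.* toℚ (absCoeff (suc N) M))
      ≡⟨ trans (toℚ-* (ballot (suc p) j) _) (cong (toℚ (ballot (suc p) j) ℚ.*_) (toℚ-* (sgnℤ M) _)) ⟨
    toℚ (ballot (suc p) j * (sgnℤ M * absCoeff (suc N) M))
      ≡⟨ cong (λ N′ → toℚ (ballot (suc p) j * (sgnℤ M * absCoeff N′ M))) (ℕ.+-suc (j ℕ.+ j) p) ⟨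
    toℚ (ballot (suc p) j * P⁻¹^ (j ℕ.+ j ℕ.+ suc p) M) ∎
    where
    open ≡-Reasoning
    n N M : ℕ
    n = suc (suc (suc p)) ℕ.+ m
    N = j ℕ.+ j ℕ.+ p
    M = m ∸ j
    inner : ℕ → ℕ → ℚ
    inner M′ b = natℚ (((n ℕ.+ j ∸ b ∸ 3) C (M′ ∸ b)) ℕ.* ((M′ ∸ b) C b))
    2j+k∸1≡ : ∀ j p → 2 ℕ.* j ℕ.+ suc (suc p) ∸ 1 ≡ suc (j ℕ.+ j ℕ.+ p)
    2j+k∸1≡ j p = cong (_∸ 1) (regroup j p)
      where
      regroup : ∀ j p → 2 ℕ.* j ℕ.+ suc (suc p) ≡ suc (suc (j ℕ.+ j ℕ.+ p))
      regroup = ℕ-Solver.solve-∀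
    n∸k∸1∸j≡ : n ∸ suc (suc p) ∸ 1 ∸ j ≡ M
    n∸k∸1∸j≡ =
      cong (λ a → a ∸ 1 ∸ j) (trans (cong (_∸ p) (sym (ℕ.+-suc p m))) (ℕ.m+n∸m≡n p (suc m)))
    index : ∀ b → b ≤ M → n ℕ.+ j ∸ b ∸ 3 ≡ N ℕ.+ (M ∸ b)
    index b b≤M = begin
      n ℕ.+ j ∸ b ∸ 3
        ≡⟨ cong (λ a → suc (suc (suc p)) ℕ.+ a ℕ.+ j ∸ b ∸ 3) m≡j+b+[M∸b] ⟩
      suc (suc (suc p)) ℕ.+ (j ℕ.+ (b ℕ.+ (M ∸ b))) ℕ.+ j ∸ b ∸ 3
        ≡⟨ cong (λ a → a ∸ b ∸ 3) (regroup p j b (M ∸ b)) ⟩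
      b ℕ.+ (3 ℕ.+ (N ℕ.+ (M ∸ b))) ∸ b ∸ 3
        ≡⟨ cong (_∸ 3) (ℕ.m+n∸m≡n b _) ⟩
      3 ℕ.+ (N ℕ.+ (M ∸ b)) ∸ 3
        ≡⟨ ℕ.m+n∸m≡n 3 _ ⟩
      N ℕ.+ (M ∸ b) ∎
      where
      m≡j+b+[M∸b] : m ≡ j ℕ.+ (b ℕ.+ (M ∸ b))
      m≡j+b+[M∸b] = sym (trans (cong (j ℕ.+_) (ℕ.m+[n∸m]≡n b≤M)) (ℕ.m+[n∸m]≡n j≤m))
      regroup : ∀ p j b t →
        suc (suc (suc p)) ℕ.+ (j ℕ.+ (b ℕ.+ t)) ℕ.+ j ≡ b ℕ.+ (3 ℕ.+ (j ℕ.+ j ℕ.+ p ℕ.+ t))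
      regroup = ℕ-Solver.solve-∀

module Roots (q r s̃ : Ser) (q₀₀≡1 : q 0 0 ≡ + 1) (q²≈Disc : q ⊗ q ≈ Disc)
  (r-def : con (+ 2) ⊗ X ⊗ r ≈ con (+ 1) ⊕ X ⊖ X ^ˢ 2 ⊖ q)
  (s̃-def : con (+ 2) ⊗ s̃ ≈ con (+ 1) ⊕ X ⊖ X ^ˢ 2 ⊕ q) where

  open FiniteSums
  open PowerSeries
  open Bivariate
  open InversePowers using (P)
  open Polyominoes using (stanleys; sumUpTo; length-stanleys)
  open import Data.Nat as ℕ using (ℕ; zero; suc; z≤n; s≤s)
  import Data.Nat.Properties as ℕ
  open import Data.Integer using (ℤ; 0ℤ; _+_; -_)
  import Data.Integer.Properties as ℤ
  open import Data.Integer.Tactic.RingSolver using (solve-∀)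
  open import Data.List using (length)
  open import Relation.Binary.PropositionalEquality
  open SeriesSolver using (solve; _:=_; _:+_; _:*_; _:-_; :-_) renaming (con to K)

  UFree-Disc : UFree Disc
  UFree-Disc = UFree-⊕ (UFree-⊖ (UFree-⊖ (UFree-⊖ (UFree-^ˢ 4 UFree-X)
    (UFree-⊗ (UFree-con (+ 2)) (UFree-^ˢ 3 UFree-X))) (UFree-^ˢ 2 UFree-X))
    (UFree-⊗ (UFree-con (+ 2)) UFree-X)) (UFree-con (+ 1))

  UFree-q : UFree q
  UFree-q = square-UFree⇒UFree q q₀₀≡1
    (u-free λ n j → trans (q²≈Disc n (suc j)) ([u^suc]≡0 UFree-Disc n j))

  UFree-1+X-X² : UFree (con (+ 1) ⊕ X ⊖ X ^ˢ 2)
  UFree-1+X-X² = UFree-⊖ (UFree-⊕ (UFree-con (+ 1)) UFree-X) (UFree-^ˢ 2 UFree-X)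

  [u^0]-2X : [u^ 0 ] (con (+ 2) ⊗ X) ≐ constₛ (+ 2) *ₛ xₛ
  [u^0]-2X = *ₛ-cong ([u^0]-con (+ 2)) [u^0]-X

  UFree-r : UFree r
  UFree-r = UFree-⊗⁻ (con (+ 2) ⊗ X) r (UFree-⊗ (UFree-con (+ 2)) UFree-X) 2x-cancel
    (u-free λ n j → trans (r-def n (suc j)) ([u^suc]≡0 (UFree-⊖ UFree-1+X-X² UFree-q) n j))
    where
    2x-cancel : ∀ g → [u^ 0 ] (con (+ 2) ⊗ X) *ₛ g ≐ 0ₛ → g ≐ 0ₛ
    2x-cancel g 2xg≐0 = x*ₛ≐0⇒≐0 g (constₛ*ₛ≐0⇒≐0 (+ 2) (xₛ *ₛ g) (λ ())
      (≐-trans (≐-sym (*ₛ-assoc (constₛ (+ 2)) xₛ g))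
               (≐-trans (*ₛ-cong (≐-sym [u^0]-2X) (≐-refl {g})) 2xg≐0)))

  UFree-s̃ : UFree s̃
  UFree-s̃ = UFree-⊗⁻ (con (+ 2)) s̃ (UFree-con (+ 2))
    (λ g 2g≐0 → constₛ*ₛ≐0⇒≐0 (+ 2) g (λ ())
      (λ n → trans (*ₛ-cong (≐-sym ([u^0]-con (+ 2))) (≐-refl {g}) n) (2g≐0 n)))
    (u-free λ n j → trans (s̃-def n (suc j)) ([u^suc]≡0 (UFree-⊕ UFree-1+X-X² UFree-q) n j))

  Q R S Δ T : Series
  Q = [u^ 0 ] q
  R = [u^ 0 ] r
  S = [u^ 0 ] s̃
  Δ = xₛ ^ₛ 4 -ₛ constₛ (+ 2) *ₛ xₛ ^ₛ 3 -ₛ xₛ ^ₛ 2 -ₛ constₛ (+ 2) *ₛ xₛ +ₛ 1ₛ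
  T = R *ₛ xₛ

  [u^0]-1+X-X² : [u^ 0 ] (con (+ 1) ⊕ X ⊖ X ^ˢ 2) ≐ P
  [u^0]-1+X-X² n = cong₂ (λ a b → a + - b) (cong₂ _+_ ([u^0]-con (+ 1) n) ([u^0]-X n)) ([u^0]-X^ˢ 2 n)

  Q²≐Δ : Q *ₛ Q ≐ Δ
  Q²≐Δ n = trans (q²≈Disc n 0)
    (cong₂ _+_ (cong₂ (λ a b → a + - b) (cong₂ (λ a b → a + - b) (cong₂ (λ a b → a + - b)
      ([u^0]-X^ˢ 4 n)
      (*ₛ-cong ([u^0]-con (+ 2)) ([u^0]-X^ˢ 3) n))
      ([u^0]-X^ˢ 2 n))
      (*ₛ-cong ([u^0]-con (+ 2)) [u^0]-X n))
      ([u^0]-con (+ 1) n))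

  2xR≐P-Q : constₛ (+ 2) *ₛ xₛ *ₛ R ≐ P -ₛ Q
  2xR≐P-Q n = trans (*ₛ-cong (≐-sym [u^0]-2X) (≐-refl {R}) n)
    (trans (r-def n 0) (cong (λ a → a + - Q n) ([u^0]-1+X-X² n)))

  2S≐P+Q : constₛ (+ 2) *ₛ S ≐ P +ₛ Q
  2S≐P+Q n = trans (*ₛ-cong (≐-sym ([u^0]-con (+ 2))) (≐-refl {S}) n)
    (trans (s̃-def n 0) (cong (_+ Q n) ([u^0]-1+X-X² n)))

  -- T = r x is the root of t² - P t + x = 0 with t(0) = 0: (P - q)² - q² = P² - Δ = 4x.
  T-quadratic : T *ₛ T -ₛ P *ₛ T +ₛ xₛ ≐ 0ₛ
  T-quadratic = constₛ*ₛ≐0⇒≐0 (+ 4) _ (λ ()) (≐-trans identity (+ₛ-cong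
      (zeroˡ⇒*ₛ≐0 (2xR -ₛ P -ₛ Q) (≐⇒-ₛ≐0 2xR≐P-Q)) (≐⇒-ₛ≐0 Q²≐Δ)))
    where
    2xR = constₛ (+ 2) *ₛ xₛ *ₛ R
    identity : constₛ (+ 4) *ₛ (T *ₛ T -ₛ P *ₛ T +ₛ xₛ) ≐
               (2xR -ₛ (P -ₛ Q)) *ₛ (2xR -ₛ P -ₛ Q) +ₛ (Q *ₛ Q -ₛ Δ)
    identity = solve 3 (λ x r q →
      let p = K (+ 1) :+ x :- x :* (x :* K (+ 1))
          t = r :* x
          a = K (+ 2) :* x :* r
          d = x :* (x :* (x :* (x :* K (+ 1)))) :- K (+ 2) :* (x :* (x :* (x :* K (+ 1))))
                :- x :* (x :* K (+ 1)) :- K (+ 2) :* x :+ K (+ 1)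
      in K (+ 4) :* (t :* t :- p :* t :+ x) := (a :- (p :- q)) :* (a :- p :- q) :+ (q :* q :- d))
      ≐-refl xₛ R Q

  R*S≐1 : R *ₛ S ≐ 1ₛ
  R*S≐1 = -ₛ≐0⇒≐ (x*ₛ≐0⇒≐0 _ (constₛ*ₛ≐0⇒≐0 (+ 4) _ (λ ()) (≐-trans identity vanishes)))
    where
    2xR 2S : Series
    2xR = constₛ (+ 2) *ₛ xₛ *ₛ R
    2S  = constₛ (+ 2) *ₛ S
    identity : constₛ (+ 4) *ₛ (xₛ *ₛ (R *ₛ S -ₛ 1ₛ)) ≐
               (2xR -ₛ (P -ₛ Q)) *ₛ 2S +ₛ (P -ₛ Q) *ₛ (2S -ₛ (P +ₛ Q)) -ₛ (Q *ₛ Q -ₛ Δ)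
    identity = solve 4 (λ x r q s →
      let p = K (+ 1) :+ x :- x :* (x :* K (+ 1))
          a = K (+ 2) :* x :* r
          d = x :* (x :* (x :* (x :* K (+ 1)))) :- K (+ 2) :* (x :* (x :* (x :* K (+ 1))))
                :- x :* (x :* K (+ 1)) :- K (+ 2) :* x :+ K (+ 1)
      in K (+ 4) :* (x :* (r :* s :- K (+ 1)))
           := (a :- (p :- q)) :* (K (+ 2) :* s) :+ (p :- q) :* (K (+ 2) :* s :- (p :+ q)) :- (q :* q :- d))
      ≐-refl xₛ R Q S
    vanishes : (2xR -ₛ (P -ₛ Q)) *ₛ 2S +ₛ (P -ₛ Q) *ₛ (2S -ₛ (P +ₛ Q)) -ₛ (Q *ₛ Q -ₛ Δ) ≐ 0ₛ
    vanishes n = cong₂ _+_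
      (+ₛ-cong (zeroˡ⇒*ₛ≐0 2S (≐⇒-ₛ≐0 2xR≐P-Q))
               (zeroʳ⇒*ₛ≐0 (P -ₛ Q) (≐⇒-ₛ≐0 2S≐P+Q)) n)
      (cong -_ (≐⇒-ₛ≐0 Q²≐Δ n))

  P*R≐1+xR² : P *ₛ R ≐ 1ₛ +ₛ xₛ *ₛ (R *ₛ R)
  P*R≐1+xR² = -ₛ≐0⇒≐ (x*ₛ≐0⇒≐0 _ (≐-trans identity (λ n → cong -_ (T-quadratic n))))
    where
    identity : xₛ *ₛ (P *ₛ R -ₛ (1ₛ +ₛ xₛ *ₛ (R *ₛ R))) ≐ -ₛ (T *ₛ T -ₛ P *ₛ T +ₛ xₛ)
    identity = solve 2 (λ x r →
      let p = K (+ 1) :+ x :- x :* (x :* K (+ 1))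
          t = r :* x
      in x :* (p :* r :- (K (+ 1) :+ x :* (r :* r))) := :- (t :* t :- p :* t :+ x))
      ≐-refl xₛ R

  H : ℕ → Series
  H zero    = 0ₛ
  H (suc k) = xₛ ^ₛ 2 *ₛ T ^ₛ k

  order-H : ∀ k → OrderAtLeast (suc (suc k)) (H (suc k))
  order-H k = order-*ₛ 2 k (order-^ₛ 2 order-x) (order-^ₛ k (order-*ₛ 0 1 (order-0 R) order-x))

  H-recurrence : ∀ k → H (suc (suc (suc k))) ≐ P *ₛ H (suc (suc k)) -ₛ xₛ *ₛ H (suc k)
  H-recurrence k = -ₛ≐0⇒≐ (≐-trans identity (zeroʳ⇒*ₛ≐0 (H (suc k)) T-quadratic))
    where
    identity : H (suc (suc (suc k))) -ₛ (P *ₛ H (suc (suc k)) -ₛ xₛ *ₛ H (suc k)) ≐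
               H (suc k) *ₛ (T *ₛ T -ₛ P *ₛ T +ₛ xₛ)
    identity = solve 3 (λ x r w →
      let p  = K (+ 1) :+ x :- x :* (x :* K (+ 1))
          t  = r :* x
          x² = x :* (x :* K (+ 1))
      in x² :* (t :* (t :* w)) :- (p :* (x² :* (t :* w)) :- x :* (x² :* w)) := x² :* w :* (t :* t :- p :* t :+ x))
      ≐-refl xₛ R (T ^ₛ k)

  H-difference : ℕ → Series
  H-difference k = H (suc k) -ₛ xₛ *ₛ H k

  H-difference-step : ∀ k →
    H-difference (suc k) ≐ H-difference (suc (suc k)) +ₛ xₛ ^ₛ 2 *ₛ H (suc (suc k))
  H-difference-step k = -ₛ≐0⇒≐ (≐-trans identity (≐⇒-ₛ≐0 (≐-sym (H-recurrence k))))
    where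
    identity : H-difference (suc k) -ₛ (H-difference (suc (suc k)) +ₛ xₛ ^ₛ 2 *ₛ H (suc (suc k))) ≐
               (P *ₛ H (suc (suc k)) -ₛ xₛ *ₛ H (suc k)) -ₛ H (suc (suc (suc k)))
    identity = solve 4 (λ x h₃ h₂ h₁ →
      let p  = K (+ 1) :+ x :- x :* (x :* K (+ 1))
          x² = x :* (x :* K (+ 1))
      in (h₂ :- x :* h₁) :- ((h₃ :- x :* h₂) :+ x² :* h₂) := (p :* h₂ :- x :* h₁) :- h₃)
      ≐-refl xₛ (H (suc (suc (suc k)))) (H (suc (suc k))) (H (suc k))

  H-difference-telescope : ∀ k L n →
    H-difference (suc k) (suc (suc n)) ≡
    H-difference (suc (L ℕ.+ k)) (suc (suc n)) + sumℤ< L (λ i → H (suc (suc (i ℕ.+ k))) n)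
  H-difference-telescope k zero    n = sym (ℤ.+-identityʳ _)
  H-difference-telescope k (suc L) n = begin
    H-difference (suc k) (suc (suc n))
      ≡⟨ H-difference-telescope k L n ⟩
    H-difference (suc (L ℕ.+ k)) (suc (suc n)) + Σ
      ≡⟨ cong (_+ Σ) (H-difference-step (L ℕ.+ k) (suc (suc n))) ⟩
    (H-difference (suc (suc L ℕ.+ k)) (suc (suc n)) + (xₛ ^ₛ 2 *ₛ H (suc (suc L ℕ.+ k))) (suc (suc n))) + Σ
      ≡⟨ cong (λ h → (H-difference (suc (suc L ℕ.+ k)) (suc (suc n)) + h) + Σ)
              (x^ₛ*ₛ-shift 2 (H (suc (suc L ℕ.+ k))) n) ⟩
    (H-difference (suc (suc L ℕ.+ k)) (suc (suc n)) + H (suc (suc L ℕ.+ k)) n) + Σ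
      ≡⟨ rotate (H-difference (suc (suc L ℕ.+ k)) (suc (suc n))) (H (suc (suc L ℕ.+ k)) n) Σ ⟩
    H-difference (suc (suc L ℕ.+ k)) (suc (suc n)) + (Σ + H (suc (suc L ℕ.+ k)) n) ∎
    where
    open ≡-Reasoning
    Σ = sumℤ< L (λ i → H (suc (suc (i ℕ.+ k))) n)
    rotate : ∀ a b c → (a + b) + c ≡ a + (c + b)
    rotate = solve-∀

  -- The difference H (k + 1) - x H k has order k + 2, so the telescoping sum ends after n steps.
  H-coeff-recurrence : ∀ k n →
    H (suc (suc k)) (suc (suc n)) ≡ H (suc k) (suc n) + sumℤ< n (λ i → H (suc (suc (i ℕ.+ k))) n)
  H-coeff-recurrence k n = begin
    H (suc (suc k)) (suc (suc n))
      ≡⟨ split (H (suc (suc k)) (suc (suc n))) ((xₛ *ₛ H (suc k)) (suc (suc n))) ⟩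
    (xₛ *ₛ H (suc k)) (suc (suc n)) + H-difference (suc k) (suc (suc n))
      ≡⟨ cong₂ _+_ (x*ₛ-shift (H (suc k)) (suc n)) (H-difference-telescope k n n) ⟩
    H (suc k) (suc n) + (H-difference (suc (n ℕ.+ k)) (suc (suc n)) + Σ)
      ≡⟨ cong (λ d → H (suc k) (suc n) + (d + Σ)) H-difference-vanishes ⟩
    H (suc k) (suc n) + (0ℤ + Σ)
      ≡⟨ cong (λ z → H (suc k) (suc n) + z) (ℤ.+-identityˡ Σ) ⟩
    H (suc k) (suc n) + Σ ∎
    where
    open ≡-Reasoning
    Σ = sumℤ< n (λ i → H (suc (suc (i ℕ.+ k))) n)
    split : ∀ h xh → h ≡ xh + (h + - xh)
    split = solve-∀
    H-difference-vanishes : H-difference (suc (n ℕ.+ k)) (suc (suc n)) ≡ 0ℤ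
    H-difference-vanishes = cong₂ (λ a b → a + - b)
      (order-H (suc (n ℕ.+ k)) (suc (suc n)) (s≤s (s≤s (s≤s (ℕ.m≤m+n n k)))))
      (trans (x*ₛ-shift (H (suc (n ℕ.+ k))) (suc n))
             (order-H (n ℕ.+ k) (suc n) (s≤s (s≤s (ℕ.m≤m+n n k)))))

  +-sumUpTo : ∀ L (f : ℕ → ℕ) → + sumUpTo L f ≡ sumℤ< L (λ i → + f i)
  +-sumUpTo zero    f = refl
  +-sumUpTo (suc L) f = trans (ℤ.pos-+ (sumUpTo L f) (f L)) (cong (_+ + f L) (+-sumUpTo L f))

  length-stanleys≡H : ∀ n k → + length (stanleys n k) ≡ H k n
  length-stanleys≡H zero          zero    = refl
  length-stanleys≡H zero          (suc k) = sym (order-H k 0 (s≤s z≤n))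
  length-stanleys≡H (suc zero)    zero    = refl
  length-stanleys≡H (suc zero)    (suc k) = sym (order-H k 1 (s≤s (s≤s z≤n)))
  length-stanleys≡H (suc (suc n)) zero    = refl
  length-stanleys≡H (suc (suc zero))    (suc zero) = sym (x^ₛ*ₛ-shift 2 1ₛ 0)
  length-stanleys≡H (suc (suc (suc n))) (suc zero) = sym (x^ₛ*ₛ-shift 2 1ₛ (suc n))
  length-stanleys≡H (suc (suc n)) (suc (suc k)) = begin
    + length (stanleys (suc (suc n)) (suc (suc k)))
      ≡⟨ cong +_ (length-stanleys n k) ⟩
    + (length (stanleys (suc n) (suc k)) ℕ.+ sumUpTo n (λ i → length (stanleys n (suc (suc (k ℕ.+ i))))))
      ≡⟨ ℤ.pos-+ (length (stanleys (suc n) (suc k))) _ ⟩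
    + length (stanleys (suc n) (suc k)) + + sumUpTo n (λ i → length (stanleys n (suc (suc (k ℕ.+ i)))))
      ≡⟨ cong₂ _+_ (length-stanleys≡H (suc n) (suc k)) (trans (+-sumUpTo n _) (sumℤ<-ext n (λ i →
           trans (length-stanleys≡H n (suc (suc (k ℕ.+ i))))
                 (cong (λ m → H (suc (suc m)) n) (ℕ.+-comm k i))))) ⟩
    H (suc k) (suc n) + sumℤ< n (λ i → H (suc (suc (i ℕ.+ k))) n)
      ≡⟨ H-coeff-recurrence k n ⟨
    H (suc (suc k)) (suc (suc n)) ∎
    where open ≡-Reasoning

module GeneratingFunction (q r s̃ : Ser) (q₀₀≡1 : q 0 0 ≡ + 1) (q²≈Disc : q ⊗ q ≈ Disc)
  (r-def : con (+ 2) ⊗ X ⊗ r ≈ con (+ 1) ⊕ X ⊖ X ^ˢ 2 ⊖ q)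
  (s̃-def : con (+ 2) ⊗ s̃ ≈ con (+ 1) ⊕ X ⊖ X ^ˢ 2 ⊕ q)
  (g : ℕ → ℕ → ℕ) (g-counts : ∀ n k → IsCount n k (g n k)) where

  open FiniteSums
  open PowerSeries
  open Bivariate
  open Polyominoes using (IsCount⇒length)
  open InversePowers using (P; P⁻¹^)
  open Ballot using (ballot)
  open Rationals using (toℚ; toℚ-sum; sumℚ<-cong)
  open ExplicitFormula using (formulaTerm; formulaTerm≡)
  open Roots q r s̃ q₀₀≡1 q²≈Disc r-def s̃-def
  open LagrangePowers using (R^-coeff)
  open import Data.Nat as ℕ using (zero; suc; _∸_; _≤_; s≤s)
  import Data.Nat.Properties as ℕ
  open import Data.Integer using (ℤ; 0ℤ; _+_; _*_; -_)
  import Data.Integer.Properties as ℤ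
  open import Relation.Binary.PropositionalEquality
  open SeriesSolver using (solve; _:=_; _:+_; _:*_; _:-_; :-_) renaming (con to K)

  G : Ser
  G = toSer g

  [u^]-G : ∀ k → [u^ k ] G ≐ H k
  [u^]-G k n = trans (cong +_ (IsCount⇒length n k (g n k) (g-counts n k))) (length-stanleys≡H n k)

  G-column : ∀ k n → 1 ≤ k → G n k ≡ (X ^ˢ 2 ⊗ (r ⊗ X) ^ˢ (k ∸ 1)) n 0
  G-column (suc k) n _ = trans ([u^]-G (suc k) n) (sym (*ₛ-cong ([u^0]-X^ˢ 2) [u^0]-T^ n))
    where
    [u^0]-T^ : [u^ 0 ] ((r ⊗ X) ^ˢ k) ≐ T ^ₛ k
    [u^0]-T^ = ≐-trans ([u^0]-^ˢ (r ⊗ X) k) (^ₛ-cong (*ₛ-cong (≐-refl {R}) [u^0]-X) k)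

  [u^]-X⊗X⊗U : ∀ k → [u^ k ] (X ⊗ (X ⊗ U)) ≐ xₛ *ₛ (xₛ *ₛ [u^ k ] U)
  [u^]-X⊗X⊗U k n = trans ([u^]-⊗-UFreeˡ X (X ⊗ U) UFree-X k n)
    (*ₛ-cong [u^0]-X (≐-trans ([u^]-⊗-UFreeˡ X U UFree-X k) (*ₛ-cong [u^0]-X (≐-refl {[u^ k ] U}))) n)

  denominator : Ser
  denominator = r ⊗ (s̃ ⊖ X ⊗ U)

  [u^]-denominator : ∀ k → [u^ k ] denominator ≐ R *ₛ ([u^ k ] s̃ -ₛ xₛ *ₛ [u^ k ] U)
  [u^]-denominator k n = trans ([u^]-⊗-UFreeˡ r (s̃ ⊖ X ⊗ U) UFree-r k n)
    (sum-ext n (λ i → cong (λ z → R i * (s̃ (n ∸ i) k + - z))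
      (trans ([u^]-⊗-UFreeˡ X U UFree-X k (n ∸ i)) (*ₛ-cong [u^0]-X (≐-refl {[u^ k ] U}) (n ∸ i)))))

  [u^0]-denominator : [u^ 0 ] denominator ≐ 1ₛ
  [u^0]-denominator = ≐-trans ([u^]-denominator 0) (≐-trans (*ₛ-cong (≐-refl {R}) S-xU₀≐S) R*S≐1)
    where
    S-xU₀≐S : [u^ 0 ] s̃ -ₛ xₛ *ₛ [u^ 0 ] U ≐ S
    S-xU₀≐S n = trans (cong (λ z → S n + - z) (zeroʳ⇒*ₛ≐0 xₛ [u^0]-U n)) (ℤ.+-identityʳ (S n))

  [u^1]-denominator : [u^ 1 ] denominator ≐ -ₛ T
  [u^1]-denominator = ≐-trans ([u^]-denominator 1) (≐-trans (*ₛ-cong (≐-refl {R}) S-xU₁≐-x)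
    (solve 2 (λ x r → r :* (K (+ 0) :- x :* K (+ 1)) := :- (r :* x)) ≐-refl xₛ R))
    where
    S-xU₁≐-x : [u^ 1 ] s̃ -ₛ xₛ *ₛ [u^ 1 ] U ≐ constₛ (+ 0) -ₛ xₛ *ₛ constₛ (+ 1)
    S-xU₁≐-x n = cong₂ (λ a b → a + - b)
      (trans ([u^suc]≡0 UFree-s̃ n 0) (sym (constₛ-0 n)))
      (*ₛ-cong (≐-refl {xₛ}) [u^1]-U n)

  [u^2+]-denominator : ∀ j → [u^ suc (suc j) ] denominator ≐ 0ₛ
  [u^2+]-denominator j = ≐-trans ([u^]-denominator (suc (suc j)))
    (zeroʳ⇒*ₛ≐0 R (λ n → cong₂ (λ a b → a + - b)
      ([u^suc]≡0 UFree-s̃ n (suc j)) (zeroʳ⇒*ₛ≐0 xₛ ([u^2+]-U j) n)))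

  G⊗denominator≈X⊗X⊗U : G ⊗ denominator ≈ X ⊗ (X ⊗ U)
  G⊗denominator≈X⊗X⊗U n zero = begin
    (G ⊗ denominator) n 0       ≡⟨ zeroˡ⇒*ₛ≐0 ([u^ 0 ] denominator) ([u^]-G 0) n ⟩
    0ℤ                          ≡⟨ zeroʳ⇒*ₛ≐0 xₛ (zeroʳ⇒*ₛ≐0 xₛ [u^0]-U) n ⟨
    (xₛ *ₛ (xₛ *ₛ [u^ 0 ] U)) n ≡⟨ [u^]-X⊗X⊗U 0 n ⟨
    (X ⊗ (X ⊗ U)) n 0           ∎
    where open ≡-Reasoning
  G⊗denominator≈X⊗X⊗U n (suc k) = begin
    (G ⊗ denominator) n (suc k)
      ≡⟨ ⊗-two-columnsʳ G denominator [u^2+]-denominator n k ⟩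
    ([u^ suc k ] G *ₛ [u^ 0 ] denominator) n + ([u^ k ] G *ₛ [u^ 1 ] denominator) n
      ≡⟨ cong₂ _+_ (*ₛ-cong ([u^]-G (suc k)) [u^0]-denominator n) (*ₛ-cong ([u^]-G k) [u^1]-denominator n) ⟩
    (H (suc k) *ₛ 1ₛ) n + (H k *ₛ (-ₛ T)) n
      ≡⟨ H-T-telescopes k ⟩
    (xₛ *ₛ (xₛ *ₛ [u^ suc k ] U)) n
      ≡⟨ [u^]-X⊗X⊗U (suc k) n ⟨
    (X ⊗ (X ⊗ U)) n (suc k) ∎
    where
    open ≡-Reasoning
    H-T-telescopes : ∀ k →
      (H (suc k) *ₛ 1ₛ) n + (H k *ₛ (-ₛ T)) n ≡ (xₛ *ₛ (xₛ *ₛ [u^ suc k ] U)) n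
    H-T-telescopes zero = begin
      (H 1 *ₛ 1ₛ) n + (0ₛ *ₛ (-ₛ T)) n
        ≡⟨ cong₂ _+_ (solve 1 (λ x → x :* (x :* K (+ 1)) :* K (+ 1) :* K (+ 1) := x :* (x :* K (+ 1)))
                        ≐-refl xₛ n)
                     (*ₛ-zeroˡ (-ₛ T) n) ⟩
      (xₛ *ₛ (xₛ *ₛ 1ₛ)) n + 0ℤ
        ≡⟨ ℤ.+-identityʳ _ ⟩
      (xₛ *ₛ (xₛ *ₛ 1ₛ)) n
        ≡⟨ *ₛ-cong (≐-refl {xₛ}) (*ₛ-cong (≐-refl {xₛ}) [u^1]-U) n ⟨
      (xₛ *ₛ (xₛ *ₛ [u^ 1 ] U)) n ∎
    H-T-telescopes (suc k) = begin
      (H (suc (suc k)) *ₛ 1ₛ) n + (H (suc k) *ₛ (-ₛ T)) n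
        ≡⟨ solve 3 (λ x r w → let t = r :* x ; x² = x :* (x :* K (+ 1)) in
             (x² :* (t :* w)) :* K (+ 1) :+ (x² :* w) :* (:- t) := K (+ 0)) ≐-refl xₛ R (T ^ₛ k) n ⟩
      constₛ (+ 0) n
        ≡⟨ constₛ-0 n ⟩
      0ℤ
        ≡⟨ zeroʳ⇒*ₛ≐0 xₛ (zeroʳ⇒*ₛ≐0 xₛ ([u^2+]-U k)) n ⟨
      (xₛ *ₛ (xₛ *ₛ [u^ suc (suc k) ] U)) n ∎

  [u^0]-U² : [u^ 0 ] (U ^ˢ 2) ≐ 0ₛ
  [u^0]-U² = U⊗-zero (U ^ˢ 1)

  [u^1]-U² : [u^ 1 ] (U ^ˢ 2) ≐ 0ₛ
  [u^1]-U² n = trans (U⊗-shift (U ^ˢ 1) n 0) (U⊗-zero (con (+ 1)) n)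

  [u^2]-U² : [u^ 2 ] (U ^ˢ 2) ≐ 1ₛ
  [u^2]-U² n = trans (U⊗-shift (U ^ˢ 1) n 1) (trans (U⊗-shift (con (+ 1)) n 0) ([u^0]-con (+ 1) n))

  [u^3+]-U² : ∀ j → [u^ suc (suc (suc j)) ] (U ^ˢ 2) ≐ 0ₛ
  [u^3+]-U² j n = trans (U⊗-shift (U ^ˢ 1) n (suc (suc j)))
    (trans (U⊗-shift (con (+ 1)) n (suc j)) ([u^suc]-con (+ 1) j n))

  kernel numerator : Ser
  kernel    = U ^ˢ 2 ⊗ X ⊕ X ^ˢ 2 ⊗ U ⊖ X ⊗ U ⊖ U ⊕ con (+ 1)
  numerator = X ^ˢ 2 ⊗ U ⊖ X ⊗ U ⊖ U ⊕ con (+ 2) ⊖ q ⊗ U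

  [u^]-X^ˢ⊗U : ∀ m k → [u^ k ] (X ^ˢ m ⊗ U) ≐ xₛ ^ₛ m *ₛ [u^ k ] U
  [u^]-X^ˢ⊗U m k = ≐-trans ([u^]-⊗-UFreeˡ (X ^ˢ m) U (UFree-^ˢ m UFree-X) k)
    (*ₛ-cong ([u^0]-X^ˢ m) (≐-refl {[u^ k ] U}))

  [u^]-X⊗U : ∀ k → [u^ k ] (X ⊗ U) ≐ xₛ *ₛ [u^ k ] U
  [u^]-X⊗U k = ≐-trans ([u^]-⊗-UFreeˡ X U UFree-X k) (*ₛ-cong [u^0]-X (≐-refl {[u^ k ] U}))

  x²-x-1 : Series
  x²-x-1 = xₛ ^ₛ 2 -ₛ xₛ -ₛ 1ₛ

  kernelShape : Series → Series → Series → Series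
  kernelShape a b c = a *ₛ xₛ +ₛ xₛ ^ₛ 2 *ₛ b -ₛ xₛ *ₛ b -ₛ b +ₛ c

  kernelShape-cong : ∀ {a a′ b b′ c c′} → a ≐ a′ → b ≐ b′ → c ≐ c′ →
    kernelShape a b c ≐ kernelShape a′ b′ c′
  kernelShape-cong a≐ b≐ c≐ = +ₛ-cong (+ₛ-cong (+ₛ-cong (+ₛ-cong (*ₛ-cong a≐ (≐-refl {xₛ}))
    (*ₛ-cong (≐-refl {xₛ ^ₛ 2}) b≐)) (-ₛ-cong (*ₛ-cong (≐-refl {xₛ}) b≐))) (-ₛ-cong b≐)) c≐

  [u^]-kernel : ∀ j → [u^ j ] kernel ≐ kernelShape ([u^ j ] (U ^ˢ 2)) ([u^ j ] U) ([u^ j ] con (+ 1))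
  [u^]-kernel j = +ₛ-cong (+ₛ-cong (+ₛ-cong (+ₛ-cong
    (≐-trans ([u^]-⊗-UFreeʳ (U ^ˢ 2) X UFree-X j) (*ₛ-cong (≐-refl {[u^ j ] (U ^ˢ 2)}) [u^0]-X))
    ([u^]-X^ˢ⊗U 2 j)) (-ₛ-cong ([u^]-X⊗U j))) ≐-refl) ≐-refl

  [u^0]-kernel : [u^ 0 ] kernel ≐ 1ₛ
  [u^0]-kernel = ≐-trans ([u^]-kernel 0)
    (≐-trans (kernelShape-cong (≐0ₛ⇒≐constₛ0 [u^0]-U²) (≐0ₛ⇒≐constₛ0 [u^0]-U) ([u^0]-con (+ 1)))
      (solve 1 (λ x → let a = K (+ 0) ; b = K (+ 0) ; c = K (+ 1) in
         a :* x :+ x :* (x :* K (+ 1)) :* b :- x :* b :- b :+ c := K (+ 1)) ≐-refl xₛ))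

  [u^1]-kernel : [u^ 1 ] kernel ≐ x²-x-1
  [u^1]-kernel = ≐-trans ([u^]-kernel 1)
    (≐-trans (kernelShape-cong (≐0ₛ⇒≐constₛ0 [u^1]-U²) [u^1]-U
                               (≐0ₛ⇒≐constₛ0 ([u^suc]-con (+ 1) 0)))
      (solve 1 (λ x → let a = K (+ 0) ; b = K (+ 1) ; c = K (+ 0) ; x² = x :* (x :* K (+ 1)) in
         a :* x :+ x² :* b :- x :* b :- b :+ c := x² :- x :- K (+ 1)) ≐-refl xₛ))

  [u^2]-kernel : [u^ 2 ] kernel ≐ xₛ
  [u^2]-kernel = ≐-trans ([u^]-kernel 2)
    (≐-trans (kernelShape-cong [u^2]-U² (≐0ₛ⇒≐constₛ0 ([u^2+]-U 0))
                               (≐0ₛ⇒≐constₛ0 ([u^suc]-con (+ 1) 1)))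
      (solve 1 (λ x → let a = K (+ 1) ; b = K (+ 0) ; c = K (+ 0) in
         a :* x :+ x :* (x :* K (+ 1)) :* b :- x :* b :- b :+ c := x) ≐-refl xₛ))

  [u^3+]-kernel : ∀ j → [u^ suc (suc (suc j)) ] kernel ≐ 0ₛ
  [u^3+]-kernel j = ≐-trans ([u^]-kernel (3 ℕ.+ j))
    (≐-trans (kernelShape-cong (≐0ₛ⇒≐constₛ0 ([u^3+]-U² j)) (≐0ₛ⇒≐constₛ0 ([u^2+]-U (suc j)))
                               (≐0ₛ⇒≐constₛ0 ([u^suc]-con (+ 1) (suc (suc j)))))
    (≐-trans (solve 1 (λ x → let z = K (+ 0) in z :* x :+ x :* (x :* K (+ 1)) :* z :- x :* z :- z :+ z := z)
      ≐-refl xₛ) constₛ-0))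

  numeratorShape : Series → Series → Series
  numeratorShape b c = xₛ ^ₛ 2 *ₛ b -ₛ xₛ *ₛ b -ₛ b +ₛ c -ₛ Q *ₛ b

  numeratorShape-cong : ∀ {b b′ c c′} → b ≐ b′ → c ≐ c′ →
    numeratorShape b c ≐ numeratorShape b′ c′
  numeratorShape-cong b≐ c≐ = +ₛ-cong (+ₛ-cong (+ₛ-cong (+ₛ-cong (*ₛ-cong (≐-refl {xₛ ^ₛ 2}) b≐)
    (-ₛ-cong (*ₛ-cong (≐-refl {xₛ}) b≐))) (-ₛ-cong b≐)) c≐) (-ₛ-cong (*ₛ-cong (≐-refl {Q}) b≐))

  [u^]-numerator : ∀ j → [u^ j ] numerator ≐ numeratorShape ([u^ j ] U) ([u^ j ] con (+ 2))
  [u^]-numerator j =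
    +ₛ-cong (+ₛ-cong (+ₛ-cong (+ₛ-cong ([u^]-X^ˢ⊗U 2 j) (-ₛ-cong ([u^]-X⊗U j))) ≐-refl) ≐-refl)
            (-ₛ-cong ([u^]-⊗-UFreeˡ q U UFree-q j))

  [u^0]-numerator : [u^ 0 ] numerator ≐ constₛ (+ 2)
  [u^0]-numerator = ≐-trans ([u^]-numerator 0)
    (≐-trans (numeratorShape-cong (≐0ₛ⇒≐constₛ0 [u^0]-U) ([u^0]-con (+ 2)))
      (solve 2 (λ x q → let b = K (+ 0) ; c = K (+ 2) in
         x :* (x :* K (+ 1)) :* b :- x :* b :- b :+ c :- q :* b := K (+ 2)) ≐-refl xₛ Q))

  [u^1]-numerator : [u^ 1 ] numerator ≐ x²-x-1 -ₛ Q
  [u^1]-numerator = ≐-trans ([u^]-numerator 1)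
    (≐-trans (numeratorShape-cong [u^1]-U (≐0ₛ⇒≐constₛ0 ([u^suc]-con (+ 2) 0)))
      (solve 2 (λ x q → let b = K (+ 1) ; c = K (+ 0) ; x² = x :* (x :* K (+ 1)) in
         x² :* b :- x :* b :- b :+ c :- q :* b := x² :- x :- K (+ 1) :- q) ≐-refl xₛ Q))

  [u^2+]-numerator : ∀ j → [u^ suc (suc j) ] numerator ≐ 0ₛ
  [u^2+]-numerator j = ≐-trans ([u^]-numerator (2 ℕ.+ j))
    (≐-trans (numeratorShape-cong (≐0ₛ⇒≐constₛ0 ([u^2+]-U j))
                                  (≐0ₛ⇒≐constₛ0 ([u^suc]-con (+ 2) (suc j))))
    (≐-trans (solve 2 (λ x q → let z = K (+ 0) in x :* (x :* K (+ 1)) :* z :- x :* z :- z :+ z :- q :* z := z)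
      ≐-refl xₛ Q) constₛ-0))

  [u^]-2kernel : ∀ j → [u^ j ] (con (+ 2) ⊗ kernel) ≐ constₛ (+ 2) *ₛ [u^ j ] kernel
  [u^]-2kernel j = ≐-trans ([u^]-⊗-UFreeˡ (con (+ 2)) kernel (UFree-con (+ 2)) j)
    (*ₛ-cong ([u^0]-con (+ 2)) (≐-refl {[u^ j ] kernel}))

  numerator⊗X²⊗U-shift : ∀ n k →
    (numerator ⊗ X ^ˢ 2 ⊗ U) n (suc k) ≡ ([u^ k ] numerator *ₛ xₛ ^ₛ 2) n
  numerator⊗X²⊗U-shift n k = trans (⊗U-shift (numerator ⊗ X ^ˢ 2) n k)
    (trans ([u^]-⊗-UFreeʳ numerator (X ^ˢ 2) (UFree-^ˢ 2 UFree-X) k n)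
           (*ₛ-cong (≐-refl {[u^ k ] numerator}) ([u^0]-X^ˢ 2) n))

  2kernel⊗G-term : ∀ j {c} → [u^ j ] kernel ≐ c → ∀ i →
    [u^ j ] (con (+ 2) ⊗ kernel) *ₛ [u^ i ] G ≐ (constₛ (+ 2) *ₛ c) *ₛ H i
  2kernel⊗G-term j kernelⱼ≐c i =
    *ₛ-cong (≐-trans ([u^]-2kernel j) (*ₛ-cong (≐-refl {constₛ (+ 2)}) kernelⱼ≐c)) ([u^]-G i)

  kernel⊗H : ℕ → Series
  kernel⊗H k = H (suc (suc k)) +ₛ x²-x-1 *ₛ H (suc k) +ₛ xₛ *ₛ H k

  2kernel⊗G-column₂₊ : ∀ n k →
    (con (+ 2) ⊗ kernel ⊗ G) n (suc (suc k)) ≡ (constₛ (+ 2) *ₛ kernel⊗H k) n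
  2kernel⊗G-column₂₊ n k = begin
    (con (+ 2) ⊗ kernel ⊗ G) n (suc (suc k))
      ≡⟨ ⊗-three-columnsˡ (con (+ 2) ⊗ kernel) G
           (λ j → ≐-trans ([u^]-2kernel (3 ℕ.+ j)) (zeroʳ⇒*ₛ≐0 (constₛ (+ 2)) ([u^3+]-kernel j)))
           n k ⟩
    _
      ≡⟨ cong₂ _+_ (cong₂ _+_ (2kernel⊗G-term 0 [u^0]-kernel (suc (suc k)) n)
                              (2kernel⊗G-term 1 [u^1]-kernel (suc k) n))
                   (2kernel⊗G-term 2 [u^2]-kernel k n) ⟩
    ((constₛ (+ 2) *ₛ 1ₛ) *ₛ H (suc (suc k)) +ₛ (constₛ (+ 2) *ₛ x²-x-1) *ₛ H (suc k)
       +ₛ (constₛ (+ 2) *ₛ xₛ) *ₛ H k) n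
      ≡⟨ solve 4 (λ x h₂ h₁ h₀ → let c = x :* (x :* K (+ 1)) :- x :- K (+ 1) in
           (K (+ 2) :* K (+ 1)) :* h₂ :+ (K (+ 2) :* c) :* h₁ :+ (K (+ 2) :* x) :* h₀
           := K (+ 2) :* (h₂ :+ c :* h₁ :+ x :* h₀)) ≐-refl xₛ (H (suc (suc k))) (H (suc k)) (H k) n ⟩
    (constₛ (+ 2) *ₛ kernel⊗H k) n ∎
    where open ≡-Reasoning

  kernel-form : con (+ 2) ⊗ kernel ⊗ G ≈ numerator ⊗ X ^ˢ 2 ⊗ U
  kernel-form n zero = trans (zeroʳ⇒*ₛ≐0 ([u^ 0 ] (con (+ 2) ⊗ kernel)) ([u^]-G 0) n)
    (sym (⊗U-zero (numerator ⊗ X ^ˢ 2) n))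
  kernel-form n (suc zero) = begin
    (con (+ 2) ⊗ kernel ⊗ G) n 1
      ≡⟨ ⊗-by-columns (con (+ 2) ⊗ kernel) G n 1 ⟩
    ([u^ 0 ] (con (+ 2) ⊗ kernel) *ₛ [u^ 1 ] G) n + ([u^ 1 ] (con (+ 2) ⊗ kernel) *ₛ [u^ 0 ] G) n
      ≡⟨ cong₂ _+_ (2kernel⊗G-term 0 [u^0]-kernel 1 n)
                   (zeroʳ⇒*ₛ≐0 ([u^ 1 ] (con (+ 2) ⊗ kernel)) ([u^]-G 0) n) ⟩
    ((constₛ (+ 2) *ₛ 1ₛ) *ₛ H 1) n + 0ℤ
      ≡⟨ trans (ℤ.+-identityʳ _) (solve 1 (λ x → let x² = x :* (x :* K (+ 1)) in
           (K (+ 2) :* K (+ 1)) :* (x² :* K (+ 1)) := K (+ 2) :* x²) ≐-refl xₛ n) ⟩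
    (constₛ (+ 2) *ₛ xₛ ^ₛ 2) n
      ≡⟨ *ₛ-cong [u^0]-numerator (≐-refl {xₛ ^ₛ 2}) n ⟨
    ([u^ 0 ] numerator *ₛ xₛ ^ₛ 2) n
      ≡⟨ numerator⊗X²⊗U-shift n 0 ⟨
    (numerator ⊗ X ^ˢ 2 ⊗ U) n 1 ∎
    where open ≡-Reasoning
  kernel-form n (suc (suc zero)) = begin
    (con (+ 2) ⊗ kernel ⊗ G) n 2
      ≡⟨ 2kernel⊗G-column₂₊ n 0 ⟩
    (constₛ (+ 2) *ₛ kernel⊗H 0) n
      ≡⟨ identity n ⟩
    ((x²-x-1 -ₛ Q) *ₛ xₛ ^ₛ 2 +ₛ xₛ ^ₛ 2 *ₛ (constₛ (+ 2) *ₛ xₛ *ₛ R -ₛ (P -ₛ Q))) n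
      ≡⟨ +ₛ-cong (≐-refl {(x²-x-1 -ₛ Q) *ₛ xₛ ^ₛ 2})
                  (zeroʳ⇒*ₛ≐0 (xₛ ^ₛ 2) (≐⇒-ₛ≐0 2xR≐P-Q)) n ⟩
    ((x²-x-1 -ₛ Q) *ₛ xₛ ^ₛ 2) n + 0ℤ
      ≡⟨ ℤ.+-identityʳ _ ⟩
    ((x²-x-1 -ₛ Q) *ₛ xₛ ^ₛ 2) n
      ≡⟨ *ₛ-cong [u^1]-numerator (≐-refl {xₛ ^ₛ 2}) n ⟨
    ([u^ 1 ] numerator *ₛ xₛ ^ₛ 2) n
      ≡⟨ numerator⊗X²⊗U-shift n 1 ⟨
    (numerator ⊗ X ^ˢ 2 ⊗ U) n 2 ∎
    where
    open ≡-Reasoning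
    identity : constₛ (+ 2) *ₛ kernel⊗H 0 ≐
               (x²-x-1 -ₛ Q) *ₛ xₛ ^ₛ 2 +ₛ xₛ ^ₛ 2 *ₛ (constₛ (+ 2) *ₛ xₛ *ₛ R -ₛ (P -ₛ Q))
    identity = ≐-trans (*ₛ-cong (≐-refl {constₛ (+ 2)})
        (+ₛ-cong (≐-refl {H 2 +ₛ x²-x-1 *ₛ H 1}) (*ₛ-cong (≐-refl {xₛ}) (≐-sym constₛ-0))))
      (solve 3 (λ x r q → let x² = x :* (x :* K (+ 1)) ; t = r :* x ; p = K (+ 1) :+ x :- x² in
        K (+ 2) :* (x² :* (t :* K (+ 1)) :+ (x² :- x :- K (+ 1)) :* (x² :* K (+ 1)) :+ x :* K (+ 0))
        := (x² :- x :- K (+ 1) :- q) :* x² :+ x² :* (K (+ 2) :* x :* r :- (p :- q))) ≐-refl xₛ R Q)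
  kernel-form n (suc (suc (suc m))) = begin
    (con (+ 2) ⊗ kernel ⊗ G) n (3 ℕ.+ m)
      ≡⟨ 2kernel⊗G-column₂₊ n (suc m) ⟩
    (constₛ (+ 2) *ₛ kernel⊗H (suc m)) n
      ≡⟨ identity n ⟩
    ((constₛ (+ 2) *ₛ xₛ ^ₛ 2 *ₛ T ^ₛ m) *ₛ (T *ₛ T -ₛ P *ₛ T +ₛ xₛ)) n
      ≡⟨ zeroʳ⇒*ₛ≐0 (constₛ (+ 2) *ₛ xₛ ^ₛ 2 *ₛ T ^ₛ m) T-quadratic n ⟩
    0ℤ
      ≡⟨ zeroˡ⇒*ₛ≐0 (xₛ ^ₛ 2) ([u^2+]-numerator m) n ⟨
    ([u^ suc (suc m) ] numerator *ₛ xₛ ^ₛ 2) n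
      ≡⟨ numerator⊗X²⊗U-shift n (suc (suc m)) ⟨
    (numerator ⊗ X ^ˢ 2 ⊗ U) n (3 ℕ.+ m) ∎
    where
    open ≡-Reasoning
    identity : constₛ (+ 2) *ₛ kernel⊗H (suc m) ≐
               (constₛ (+ 2) *ₛ xₛ ^ₛ 2 *ₛ T ^ₛ m) *ₛ (T *ₛ T -ₛ P *ₛ T +ₛ xₛ)
    identity = solve 3 (λ x r w → let x² = x :* (x :* K (+ 1)) ; t = r :* x ; p = K (+ 1) :+ x :- x² in
      K (+ 2) :* (x² :* (t :* (t :* w)) :+ (x² :- x :- K (+ 1)) :* (x² :* (t :* w)) :+ x :* (x² :* w))
      := (K (+ 2) :* x² :* w) :* (t :* t :- p :* t :+ x)) ≐-refl xₛ R (T ^ₛ m)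

  H-coeff≡R^-coeff : ∀ p m → H (suc p) (suc (suc p) ℕ.+ m) ≡ (R ^ₛ p) m
  H-coeff≡R^-coeff p m = trans (H≐x^R^ (suc (suc p) ℕ.+ m)) (x^ₛ*ₛ-shift (suc (suc p)) (R ^ₛ p) m)
    where
    T^≐R^x^ : ∀ p → T ^ₛ p ≐ R ^ₛ p *ₛ xₛ ^ₛ p
    T^≐R^x^ zero    = solve 0 (K (+ 1) := K (+ 1) :* K (+ 1)) ≐-refl
    T^≐R^x^ (suc p) = ≐-trans (*ₛ-cong (≐-refl {T}) (T^≐R^x^ p))
      (solve 4 (λ r x a y → (r :* x) :* (a :* y) := (r :* a) :* (x :* y)) ≐-refl R xₛ (R ^ₛ p) (xₛ ^ₛ p))
    H≐x^R^ : H (suc p) ≐ xₛ ^ₛ suc (suc p) *ₛ R ^ₛ p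
    H≐x^R^ = ≐-trans (*ₛ-cong (≐-refl {xₛ ^ₛ 2}) (T^≐R^x^ p))
      (solve 3 (λ x a y → (x :* (x :* K (+ 1))) :* (a :* y) := (x :* (x :* y)) :* a)
        ≐-refl xₛ (R ^ₛ p) (xₛ ^ₛ p))

  coefficient-formula : ∀ n k → 2 ≤ k → k ℕ.+ 1 ≤ n → natℚ (g n k) ≡ coeffFormula n k
  coefficient-formula n (suc (suc p)) (s≤s (s≤s _)) k+1≤n =
    subst (λ n → natℚ (g n (suc (suc p))) ≡ coeffFormula n (suc (suc p))) n≡ (begin
      toℚ (+ g n′ (suc (suc p)))
        ≡⟨ cong toℚ (trans ([u^]-G (suc (suc p)) n′) (H-coeff≡R^-coeff (suc p) m)) ⟩
      toℚ ((R ^ₛ suc p) m)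
        ≡⟨ cong toℚ (R^-coeff R P*R≐1+xR² (suc p) m) ⟩
      toℚ (sumℤ≤ m (λ j → ballot (suc p) j * P⁻¹^ (j ℕ.+ j ℕ.+ suc p) (m ∸ j)))
        ≡⟨ toℚ-sum m _ ⟩
      sumℚ< (suc m) (λ j → toℚ (ballot (suc p) j * P⁻¹^ (j ℕ.+ j ℕ.+ suc p) (m ∸ j)))
        ≡⟨ sumℚ<-cong (suc m) (λ j j<1+m → formulaTerm≡ p m j (ℕ.≤-pred j<1+m)) ⟨
      sumℚ< (suc m) (formulaTerm n′ (suc (suc p)))
        ≡⟨ cong (λ L → sumℚ< L (formulaTerm n′ (suc (suc p)))) n′∸k≡ ⟨
      coeffFormula n′ (suc (suc p)) ∎)
    where
    open ≡-Reasoning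
    m  = n ∸ (suc (suc p) ℕ.+ 1)
    n′ = suc (suc (suc p)) ℕ.+ m
    n≡ : n′ ≡ n
    n≡ = trans (cong (ℕ._+ m) (ℕ.+-comm 1 (suc (suc p)))) (ℕ.m+[n∸m]≡n k+1≤n)
    n′∸k≡ : n′ ∸ suc (suc p) ≡ suc m
    n′∸k≡ = trans (cong (_∸ p) (sym (ℕ.+-suc p m))) (ℕ.m+n∸m≡n p (suc m))

open import Data.Nat using (_∸_; _≤_; _+_)
open import Data.Product using (_×_; _,_)

theorem2p6 :
  -- G(u) = Σ_P x^sper(P) u^first(P): coefficient of x^n u^k is g n k
  (g : ℕ → ℕ → ℕ) → (∀ n k → IsCount n k (g n k)) →
  -- q = √(x⁴ - 2x³ - x² - 2x + 1)  (the power series root with constant term 1)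
  (q : Ser) → q 0 0 ≡ + 1 → q ⊗ q ≈ Disc →
  -- r = (1 + x - x² - q) / (2x)
  (r : Ser) → con (+ 2) ⊗ X ⊗ r ≈ con (+ 1) ⊕ X ⊖ X ^ˢ 2 ⊖ q →
  -- s̃ = x·s, where s = (1 + x - x² + q) / (2x) is a Laurent series
  (s̃ : Ser) → con (+ 2) ⊗ s̃ ≈ con (+ 1) ⊕ X ⊖ X ^ˢ 2 ⊕ q →
  -- G = xu / (r (s - u)), i.e. G · r · (x s - x u) = x · x u
  (toSer g ⊗ (r ⊗ (s̃ ⊖ X ⊗ U)) ≈ X ⊗ (X ⊗ U))
  -- 2 (u²x + x²u - xu - u + 1) G = (x²u - xu - u + 2 - q u) x² u
  × (con (+ 2) ⊗ (U ^ˢ 2 ⊗ X ⊕ X ^ˢ 2 ⊗ U ⊖ X ⊗ U ⊖ U ⊕ con (+ 1)) ⊗ toSer g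
      ≈ (X ^ˢ 2 ⊗ U ⊖ X ⊗ U ⊖ U ⊕ con (+ 2) ⊖ q ⊗ U) ⊗ X ^ˢ 2 ⊗ U)
  -- [u^k] G = x² (r x)^(k-1)  for k ≥ 1
  × (∀ k n → 1 ≤ k → toSer g n k ≡ (X ^ˢ 2 ⊗ (r ⊗ X) ^ˢ (k ∸ 1)) n 0)
  -- explicit coefficient formula for k ≥ 2, n ≥ k + 1
  × (∀ n k → 2 ≤ k → k + 1 ≤ n → natℚ (g n k) ≡ coeffFormula n k)
theorem2p6 g g-counts q q₀₀≡1 q²≈Disc r r-def s̃ s̃-def =
  G⊗denominator≈X⊗X⊗U , kernel-form , G-column , coefficient-formula
  where open GeneratingFunction q r s̃ q₀₀≡1 q²≈Disc r-def s̃-def g g-counts
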